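{- Let $w\ge2$ be even. Define $\hat\beta_w^\pm:\hat{\mathcal E}_w^\pm\to\hat{\mathcal U}_w^\pm$ by $\hat\beta_w^\pm(E)(h,k)=E(h,k)-E(k,-h)$ for positive integers $h,k$. Then $\hat\beta_w^-$ is an isomorphism of vector spaces, and $\hat\beta_w^+$ is an epimorphism whose kernel is the one-dimensional subspace of $\hat{\mathcal E}_w^+$ spanned by $G_w$.
   Context: A weighted Dedekind symbol of weight $w$ is $E:\mathbb Z^+\times\mathbb Z\to\mathbb C$ with $E(h,k)=E(h,k+h)$ and $E(ch,ck)=c^wE(h,k)$ for $c\in\mathbb Z^+$; it is even/odd if $E(h,-k)=\pm E(h,k)$. For a polynomial $g$, $\hat g(h,k)=\frac1{hk}[g(h,k)-g(1,1)\gcd(h,k)^{w+2}]$. $\hat{\mathcal U}_w$ is the set of $\hat g$ with $g$ a homogeneous polynomial of degree $w+2$ satisfying $hg(h+k,k)+kg(h,h+k)=(h+k)g(h,k)$; $\hat{\mathcal U}_w^\pm$ are those with $\hat g(h,-k)=\pm\hat g(h,k)$. $\hat{\mathcal E}_w$ is the set of weighted Dedekind symbols $E$ of weight $w$ with $(h,k)\mapsto E(h,k)-E(k,-h)$ in $\hat{\mathcal U}_w$; $\hat{\mathcal E}_w^\pm$ its even/odd elements. $G_w(h,k)=\gcd(h,k)^w$. -}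

module Defs where

open import Level using (_⊔_) renaming (suc to lsuc)
open import Algebra.Bundles using (CommutativeRing)
open import Data.Nat as ℕ using (ℕ; zero; suc)
open import Data.Fin using (Fin; toℕ)
open import Data.Integer as ℤ using (ℤ; +_; -[1+_]; 0ℤ; 1ℤ)
open import Data.Integer.GCD using (gcd)
open import Data.Product using (Σ; _×_; ∃; _,_)
open import Relation.Nullary using (¬_)

module RingOps {c ℓ} (R : CommutativeRing c ℓ) where
  open CommutativeRing R
  import Data.Fin as Fin

  ιℕ : ℕ → Carrier
  ιℕ zero    = 0#
  ιℕ (suc n) = 1# + ιℕ n

  ι : ℤ → Carrier
  ι (+ n)      = ιℕ n
  ι (-[1+ n ]) = - ιℕ (suc n)

  _^_ : Carrier → ℕ → Carrier
  x ^ zero  = 1#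
  x ^ suc n = x * (x ^ n)

  sumFin : (n : ℕ) → (Fin n → Carrier) → Carrier
  sumFin zero    f = 0#
  sumFin (suc n) f = f Fin.zero + sumFin n (λ i → f (Fin.suc i))

record Field c ℓ : Set (lsuc (c ⊔ ℓ)) where
  field
    commutativeRing : CommutativeRing c ℓ
  open CommutativeRing commutativeRing public
  open RingOps commutativeRing public
  field
    _⁻¹        : Carrier → Carrier
    ⁻¹-inverse : ∀ x → ¬ (x ≈ 0#) → (x * (x ⁻¹)) ≈ 1#
    char0      : ∀ n → ¬ (ιℕ (suc n) ≈ 0#)

module _ {c ℓ} (F : Field c ℓ) where
  open Field F

  -- Functions ℤ⁺ × ℤ → K are modelled as ℤ → ℤ → K; only their values at
  -- positive first argument matter (all predicates quantify over h > 0).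
  Sym : Set c
  Sym = ℤ → ℤ → Carrier

  _≐_ : Sym → Sym → Set ℓ
  E ≐ E′ = ∀ h k → 0ℤ ℤ.< h → E h k ≈ E′ h k

  IsWDS : ℕ → Sym → Set ℓ
  IsWDS w E =
      (∀ h k → 0ℤ ℤ.< h → E h k ≈ E h (k ℤ.+ h))
    × (∀ (c : ℕ) h k → 0ℤ ℤ.< h → E (+ suc c ℤ.* h) (+ suc c ℤ.* k) ≈ (ι (+ suc c) ^ w) * E h k)

  IsEvenSym IsOddSym : Sym → Set ℓ
  IsEvenSym E = ∀ h k → 0ℤ ℤ.< h → E h (ℤ.- k) ≈ E h k
  IsOddSym  E = ∀ h k → 0ℤ ℤ.< h → E h (ℤ.- k) ≈ - E h k

  HomPoly : ℕ → Set c
  HomPoly d = Fin (suc d) → Carrier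

  evalK : ∀ {d} → HomPoly d → Carrier → Carrier → Carrier
  evalK {d} a x y = sumFin (suc d) (λ i → a i * ((x ^ toℕ i) * (y ^ (d ℕ.∸ toℕ i))))

  evalℤ : ∀ {d} → HomPoly d → ℤ → ℤ → Carrier
  evalℤ a h k = evalK a (ι h) (ι k)

  InU : (w : ℕ) → HomPoly (w ℕ.+ 2) → Set (c ⊔ ℓ)
  InU w g = ∀ x y → (x * evalK g (x + y) y) + (y * evalK g x (x + y)) ≈ (x + y) * evalK g x y

  hat : (w : ℕ) → HomPoly (w ℕ.+ 2) → Sym
  hat w g h k = (ι (h ℤ.* k) ⁻¹) * (evalℤ g h k - (evalℤ g 1ℤ 1ℤ * (ι (gcd h k) ^ (w ℕ.+ 2))))

  InU⁺ InU⁻ : (w : ℕ) → HomPoly (w ℕ.+ 2) → Set (c ⊔ ℓ)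
  InU⁺ w g = InU w g × (∀ h k → 0ℤ ℤ.< h → 0ℤ ℤ.< k → hat w g h (ℤ.- k) ≈ hat w g h k)
  InU⁻ w g = InU w g × (∀ h k → 0ℤ ℤ.< h → 0ℤ ℤ.< k → hat w g h (ℤ.- k) ≈ - hat w g h k)

  β : Sym → Sym
  β E h k = E h k - E k (ℤ.- h)

  AgreesWithHat : (w : ℕ) → HomPoly (w ℕ.+ 2) → Sym → Set ℓ
  AgreesWithHat w g u = ∀ h k → 0ℤ ℤ.< h → 0ℤ ℤ.< k → u h k ≈ hat w g h k

  InÛ InÛ⁺ InÛ⁻ : ℕ → Sym → Set (c ⊔ ℓ)
  InÛ  w u = Σ (HomPoly (w ℕ.+ 2)) λ g → InU  w g × AgreesWithHat w g u
  InÛ⁺ w u = Σ (HomPoly (w ℕ.+ 2)) λ g → InU⁺ w g × AgreesWithHat w g u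
  InÛ⁻ w u = Σ (HomPoly (w ℕ.+ 2)) λ g → InU⁻ w g × AgreesWithHat w g u

  InÊ InÊ⁺ InÊ⁻ : ℕ → Sym → Set (c ⊔ ℓ)
  InÊ  w E = IsWDS w E × InÛ w (β E)
  InÊ⁺ w E = InÊ w E × IsEvenSym E
  InÊ⁻ w E = InÊ w E × IsOddSym E

  G : ℕ → Sym
  G w h k = ι (gcd h k) ^ w

  0S : Sym
  0S h k = 0#

  _·S_ : Carrier → Sym → Sym
  (a ·S E) h k = a * E h k

{-# OPTIONS --safe #-}
-- Write f for the polynomial function of g and c₀ = g(1,1), so that hk ĝ(h,k) = f(h,k) − c₀ gcd(h,k)ʷ⁺².
--
-- Kernel: if β(E) = 0 then periodicity, E(h,k) = E(k,−h) and the parity of E run the Euclidean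
-- algorithm down to E(h,0) = hʷ E(1,0); an odd E has E(1,0) = 0, an even one is E(1,0) G_w.
--
-- Image: if E has parity s then β(E) is σ-symmetric with σ = −s, and for ĝ this symmetry is
-- equivalent to ĝ having parity s. The equivalence passes through f: the functional equation of
-- U_w makes (f(a,−b) − σ f(a,b))/(ab) invariant under both Euclidean moves (a,b) ↦ (a+b,b),
-- (a,a+b), and a scaling argument for polynomials in characteristic 0 (degree w+2 > 2) makes it
-- vanish at (1,1); the same scaling argument forces c₀ = 0 when σ = −1.
--
-- Surjectivity: for ĝ of parity s, the Euclidean recursion E(h,r) = ĝ(h,r) + s E(r, h mod r)
-- defines a symbol with β(E) = ĝ; the three-term relation of ĝ gives E its parity and the
-- homogeneity of ĝ its weight.
module Submission where

open import Level using (_⊔_)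
open import Algebra.Bundles using (RawRing; CommutativeRing)
open import Data.Nat as ℕ using (ℕ; zero; suc; _≤_)
import Data.Nat.Properties as ℕP
import Data.Nat.GCD as ℕGCD
open import Data.Nat.Divisibility as ℕDiv using (_∣_)
import Data.Nat.DivMod as ℕDivMod
open import Data.Integer as ℤ using (ℤ; +_; -[1+_]; 0ℤ; 1ℤ)
import Data.Integer.Properties as ℤP
import Data.Integer.DivMod as ℤDivMod
import Data.Integer.Divisibility.Signed as ℤDiv
open import Data.Integer.Tactic.RingSolver using (solve-∀)
open import Data.Integer.GCD using (gcd)
open import Data.Maybe using (Maybe; just; nothing)
open import Data.Fin as Fin using (Fin; toℕ)
open import Data.Product using (Σ; _×_; _,_; proj₁; proj₂)
open import Relation.Nullary using (¬_; yes; no)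
open import Relation.Binary.PropositionalEquality as P using (_≡_)
open import Data.Nat.Induction using (<-rec)
open import Function.Bundles using (_⇔_; mk⇔)
open import Defs
import Algebra.Solver.Ring as RingSolver
import Algebra.Solver.Ring.AlmostCommutativeRing as ACR

euclid-induction : ∀ {p} (P : ℕ → ℕ → Set p) →
  (∀ a → P (suc a) (suc a)) →
  (∀ a b → P (suc a) (suc b) → P (suc a ℕ.+ suc b) (suc b)) →
  (∀ a b → P (suc a) (suc b) → P (suc a) (suc a ℕ.+ suc b)) →
  ∀ a b → P (suc a) (suc b)
euclid-induction P diagonal left right a b = go (suc (a ℕ.+ b)) a b ℕP.≤-refl
  where
  go : ∀ n a b → a ℕ.+ b ℕ.< n → P (suc a) (suc b)
  go (suc n) a b a+b<1+n with ℕ.compare a b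
  ... | ℕ.equal a     = diagonal a
  ... | ℕ.less a k    = P.subst (P (suc a)) (P.cong suc (ℕP.+-suc a k))
    (right a k (go n a k (ℕP.<-≤-trans (ℕP.+-monoʳ-< a (ℕ.s≤s (ℕP.m≤n+m k a))) (ℕP.≤-pred a+b<1+n))))
  ... | ℕ.greater b k = P.subst (λ x → P x (suc b)) (P.cong suc (P.trans (ℕP.+-suc k b) (P.cong suc (ℕP.+-comm k b))))
    (left k b (go n k b (ℕP.<-≤-trans (ℕ.s≤s (ℕP.+-monoˡ-≤ b (ℕP.m≤n+m k b))) (ℕP.≤-pred a+b<1+n))))

gcd[n,n]≡n : ∀ n → ℕGCD.gcd n n ≡ n
gcd[n,n]≡n n = P.sym (ℕGCD.gcd-universality proj₁ (λ d∣n → d∣n , d∣n))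

gcd[m,m+n]≡gcd[m,n] : ∀ m n → ℕGCD.gcd m (m ℕ.+ n) ≡ ℕGCD.gcd m n
gcd[m,m+n]≡gcd[m,n] m n = P.sym (ℕGCD.gcd-universality
  (λ (d∣m , d∣m+n) → ℕGCD.gcd-greatest d∣m (ℕDiv.∣m+n∣m⇒∣n d∣m+n d∣m))
  (λ d∣gcd → let d∣m = ℕDiv.∣-trans d∣gcd (ℕGCD.gcd[m,n]∣m m n) in
             d∣m , ℕDiv.∣m∣n⇒∣m+n d∣m (ℕDiv.∣-trans d∣gcd (ℕGCD.gcd[m,n]∣n m n))))

gcd[m+n,n]≡gcd[m,n] : ∀ m n → ℕGCD.gcd (m ℕ.+ n) n ≡ ℕGCD.gcd m n
gcd[m+n,n]≡gcd[m,n] m n = begin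
  ℕGCD.gcd (m ℕ.+ n) n   ≡⟨ ℕGCD.gcd-comm (m ℕ.+ n) n ⟩
  ℕGCD.gcd n (m ℕ.+ n)   ≡⟨ P.cong (ℕGCD.gcd n) (ℕP.+-comm m n) ⟩
  ℕGCD.gcd n (n ℕ.+ m)   ≡⟨ gcd[m,m+n]≡gcd[m,n] n m ⟩
  ℕGCD.gcd n m           ≡⟨ ℕGCD.gcd-comm n m ⟩
  ℕGCD.gcd m n           ∎
  where
  open P.≡-Reasoning

%ℕ-unique : ∀ k h .{{_ : ℕ.NonZero h}} ρ q → ρ ℕ.< h → k ≡ + ρ ℤ.+ q ℤ.* + h → k ℤ.%ℕ h ≡ ρ
%ℕ-unique k h ρ q ρ<h k≡ρ+qh = ℤP.+-injective (P.sym (ℤP.i-j≡0⇒i≡j (+ ρ) (+ ρ′) ρ-ρ′≡0))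
  where
  ρ′ = k ℤ.%ℕ h
  t = k ℤ./ℕ h ℤ.- q
  regroup : ∀ a b q q′ h → a ℤ.- b ≡ ((a ℤ.+ q ℤ.* h) ℤ.- (b ℤ.+ q′ ℤ.* h)) ℤ.+ (q′ ℤ.- q) ℤ.* h
  regroup = solve-∀
  ρ-ρ′≡th : + ρ ℤ.- + ρ′ ≡ t ℤ.* + h
  ρ-ρ′≡th = begin
    + ρ ℤ.- + ρ′                                                          ≡⟨ regroup (+ ρ) (+ ρ′) q (k ℤ./ℕ h) (+ h) ⟩
    ((+ ρ ℤ.+ q ℤ.* + h) ℤ.- (+ ρ′ ℤ.+ k ℤ./ℕ h ℤ.* + h)) ℤ.+ t ℤ.* + h
      ≡⟨ P.cong₂ (λ x y → (x ℤ.- y) ℤ.+ t ℤ.* + h) (P.sym k≡ρ+qh) (P.sym (ℤDivMod.a≡a%ℕn+[a/ℕn]*n k h)) ⟩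
    (k ℤ.- k) ℤ.+ t ℤ.* + h                                               ≡⟨ P.cong (ℤ._+ t ℤ.* + h) (ℤP.+-inverseʳ k) ⟩
    0ℤ ℤ.+ t ℤ.* + h                                                      ≡⟨ ℤP.+-identityˡ _ ⟩
    t ℤ.* + h                                                             ∎
    where
    open P.≡-Reasoning
  ∣t∣*h<1*h : ℤ.∣ t ∣ ℕ.* h ℕ.< 1 ℕ.* h
  ∣t∣*h<1*h = begin-strict
    ℤ.∣ t ∣ ℕ.* h        ≡⟨ ℤP.abs-* t (+ h) ⟨
    ℤ.∣ t ℤ.* + h ∣      ≡⟨ P.cong ℤ.∣_∣ (P.trans (P.sym ρ-ρ′≡th) (ℤP.m-n≡m⊖n ρ ρ′)) ⟩
    ℤ.∣ ρ ℤ.⊖ ρ′ ∣       ≤⟨ ℤP.∣m⊝n∣≤m⊔n ρ ρ′ ⟩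
    ρ ℕ.⊔ ρ′             <⟨ ℕP.⊔-lub ρ<h (ℤDivMod.n%ℕd<d k h) ⟩
    h                    ≡⟨ ℕP.*-identityˡ h ⟨
    1 ℕ.* h              ∎
    where
    open ℕP.≤-Reasoning
  ρ-ρ′≡0 : + ρ ℤ.- + ρ′ ≡ 0ℤ
  ρ-ρ′≡0 = P.trans ρ-ρ′≡th (P.cong (ℤ._* + h) (ℤP.∣i∣≡0⇒i≡0 {t} (ℕP.n<1⇒n≡0 (ℕP.*-cancelʳ-< h _ _ ∣t∣*h<1*h))))

%ℕ-periodic : ∀ k h → (k ℤ.+ + suc h) ℤ.%ℕ suc h ≡ k ℤ.%ℕ suc h
%ℕ-periodic k h = %ℕ-unique (k ℤ.+ + suc h) (suc h) (k ℤ.%ℕ suc h) (k ℤ./ℕ suc h ℤ.+ 1ℤ) (ℤDivMod.n%ℕd<d k (suc h))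
  (P.trans (P.cong (ℤ._+ + suc h) (ℤDivMod.a≡a%ℕn+[a/ℕn]*n k (suc h))) (shift (+ (k ℤ.%ℕ suc h)) (k ℤ./ℕ suc h) (+ suc h)))
  where
  shift : ∀ a q h → (a ℤ.+ q ℤ.* h) ℤ.+ h ≡ a ℤ.+ (q ℤ.+ 1ℤ) ℤ.* h
  shift = solve-∀

%ℕ-homogeneous : ∀ k c h → (+ suc c ℤ.* k) ℤ.%ℕ (suc c ℕ.* suc h) ≡ suc c ℕ.* (k ℤ.%ℕ suc h)
%ℕ-homogeneous k c h = %ℕ-unique (+ suc c ℤ.* k) (suc c ℕ.* suc h) (suc c ℕ.* ρ) q (ℕP.*-monoʳ-< (suc c) (ℤDivMod.n%ℕd<d k (suc h))) (begin
    + suc c ℤ.* k                                              ≡⟨ P.cong (+ suc c ℤ.*_) (ℤDivMod.a≡a%ℕn+[a/ℕn]*n k (suc h)) ⟩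
    + suc c ℤ.* (+ ρ ℤ.+ q ℤ.* + suc h)                        ≡⟨ distribute (+ suc c) (+ ρ) q (+ suc h) ⟩
    + suc c ℤ.* + ρ ℤ.+ q ℤ.* (+ suc c ℤ.* + suc h)            ≡⟨ P.cong₂ (λ x y → x ℤ.+ q ℤ.* y) (ℤP.pos-* (suc c) ρ) (ℤP.pos-* (suc c) (suc h)) ⟨
    + (suc c ℕ.* ρ) ℤ.+ q ℤ.* + (suc c ℕ.* suc h)              ∎)
  where
  open P.≡-Reasoning
  ρ = k ℤ.%ℕ suc h
  q = k ℤ./ℕ suc h
  distribute : ∀ c a q h → c ℤ.* (a ℤ.+ q ℤ.* h) ≡ c ℤ.* a ℤ.+ q ℤ.* (c ℤ.* h)
  distribute = solve-∀

[m*n]%[m*o]≡m*[n%o] : ∀ m n o → (suc m ℕ.* n) ℕ.% (suc m ℕ.* suc o) ≡ suc m ℕ.* (n ℕ.% suc o)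
[m*n]%[m*o]≡m*[n%o] m n o = begin
  (suc m ℕ.* n) ℕ.% (suc m ℕ.* suc o)          ≡⟨ P.cong (ℕ._% (suc m ℕ.* suc o)) (ℕP.*-comm (suc m) n) ⟩
  (n ℕ.* suc m) ℕ.% suc (o ℕ.+ m ℕ.* suc o)    ≡⟨ P.cong (λ k → (n ℕ.* suc m) ℕ.% suc k) (ℕP.suc-injective (ℕP.*-comm (suc m) (suc o))) ⟩
  (n ℕ.* suc m) ℕ.% (suc o ℕ.* suc m)          ≡⟨ ℕDivMod.m%n*o≡m*o%[n*o] n (suc o) (suc m) ⟨
  (n ℕ.% suc o) ℕ.* suc m                      ≡⟨ ℕP.*-comm (n ℕ.% suc o) (suc m) ⟩
  suc m ℕ.* (n ℕ.% suc o)                      ∎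
  where
  open P.≡-Reasoning

private
  negate : ∀ a q h → ℤ.- (a ℤ.+ q ℤ.* h) ≡ ℤ.- a ℤ.+ (ℤ.- q) ℤ.* h
  negate = solve-∀

  negate-shift : ∀ a q h → ℤ.- (a ℤ.+ q ℤ.* h) ≡ (h ℤ.- a) ℤ.+ ((ℤ.- q) ℤ.- 1ℤ) ℤ.* h
  negate-shift = solve-∀

  division-with-remainder : ∀ k h {ρ} → k ℤ.%ℕ suc h ≡ ρ → k ≡ + ρ ℤ.+ (k ℤ./ℕ suc h) ℤ.* + suc h
  division-with-remainder k h P.refl = ℤDivMod.a≡a%ℕn+[a/ℕn]*n k (suc h)

%ℕ-neg-0 : ∀ k h → k ℤ.%ℕ suc h ≡ 0 → (ℤ.- k) ℤ.%ℕ suc h ≡ 0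
%ℕ-neg-0 k h k%h≡0 = %ℕ-unique (ℤ.- k) (suc h) 0 (ℤ.- (k ℤ./ℕ suc h)) ℕ.z<s
  (P.trans (P.cong ℤ.-_ (division-with-remainder k h k%h≡0)) (negate (+ 0) (k ℤ./ℕ suc h) (+ suc h)))

%ℕ-neg-suc : ∀ k h ρ → k ℤ.%ℕ suc h ≡ suc ρ → (ℤ.- k) ℤ.%ℕ suc h ≡ suc h ℕ.∸ suc ρ
%ℕ-neg-suc k h ρ k%h≡1+ρ = %ℕ-unique (ℤ.- k) (suc h) (suc h ℕ.∸ suc ρ) ((ℤ.- q) ℤ.- 1ℤ) (ℕ.s≤s (ℕP.m∸n≤m h ρ)) (begin
    ℤ.- k                                                ≡⟨ P.cong ℤ.-_ (division-with-remainder k h k%h≡1+ρ) ⟩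
    ℤ.- (+ suc ρ ℤ.+ q ℤ.* + suc h)                      ≡⟨ negate-shift (+ suc ρ) q (+ suc h) ⟩
    (+ suc h ℤ.- + suc ρ) ℤ.+ ((ℤ.- q) ℤ.- 1ℤ) ℤ.* + suc h
      ≡⟨ P.cong (ℤ._+ ((ℤ.- q) ℤ.- 1ℤ) ℤ.* + suc h) (P.trans (ℤP.m-n≡m⊖n (suc h) (suc ρ)) (ℤP.⊖-≥ 1+ρ≤1+h)) ⟩
    + (suc h ℕ.∸ suc ρ) ℤ.+ ((ℤ.- q) ℤ.- 1ℤ) ℤ.* + suc h  ∎)
  where
  open P.≡-Reasoning
  q = k ℤ./ℕ suc h
  1+ρ≤1+h : suc ρ ℕ.≤ suc h
  1+ρ≤1+h = ℕP.<⇒≤ (P.subst (ℕ._< suc h) k%h≡1+ρ (ℤDivMod.n%ℕd<d k (suc h)))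

gcd[i,j+i]≡gcd[i,j] : ∀ i j → gcd i (j ℤ.+ i) ≡ gcd i j
gcd[i,j+i]≡gcd[i,j] i j = P.cong +_ (P.sym (ℕGCD.gcd-universality common→ →common))
  where
  common→ : ∀ {d} → d ℕDiv.∣ ℤ.∣ i ∣ × d ℕDiv.∣ ℤ.∣ j ℤ.+ i ∣ → d ℕDiv.∣ ℕGCD.gcd ℤ.∣ i ∣ ℤ.∣ j ∣
  common→ {d} (d∣i , d∣j+i) = ℕGCD.gcd-greatest d∣i
    (ℤDiv.∣⇒∣ᵤ {+ d} {j} (ℤDiv.∣m+n∣n⇒∣m {+ d} {j} {i} (ℤDiv.∣ᵤ⇒∣ {+ d} {j ℤ.+ i} d∣j+i) (ℤDiv.∣ᵤ⇒∣ {+ d} {i} d∣i)))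
  →common : ∀ {d} → d ℕDiv.∣ ℕGCD.gcd ℤ.∣ i ∣ ℤ.∣ j ∣ → d ℕDiv.∣ ℤ.∣ i ∣ × d ℕDiv.∣ ℤ.∣ j ℤ.+ i ∣
  →common {d} d∣gcd = d∣i , ℤDiv.∣⇒∣ᵤ {+ d} {j ℤ.+ i} (ℤDiv.∣m∣n⇒∣m+n {+ d} {j} {i} (ℤDiv.∣ᵤ⇒∣ {+ d} {j} d∣j) (ℤDiv.∣ᵤ⇒∣ {+ d} {i} d∣i))
    where
    d∣i = ℕDiv.∣-trans d∣gcd (ℕGCD.gcd[m,n]∣m ℤ.∣ i ∣ ℤ.∣ j ∣)
    d∣j = ℕDiv.∣-trans d∣gcd (ℕGCD.gcd[m,n]∣n ℤ.∣ i ∣ ℤ.∣ j ∣)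

gcd[i,-j]≡gcd[i,j] : ∀ i j → gcd i (ℤ.- j) ≡ gcd i j
gcd[i,-j]≡gcd[i,j] i j = P.cong (λ n → + ℕGCD.gcd ℤ.∣ i ∣ n) (ℤP.∣-i∣≡∣i∣ j)

gcd[j,-i]≡gcd[i,j] : ∀ i j → gcd j (ℤ.- i) ≡ gcd i j
gcd[j,-i]≡gcd[i,j] i j = P.trans (gcd[i,-j]≡gcd[i,j] j i) (P.cong +_ (ℕGCD.gcd-comm ℤ.∣ j ∣ ℤ.∣ i ∣))

gcd[ci,cj]≡c*gcd[i,j] : ∀ c i j → gcd (+ c ℤ.* i) (+ c ℤ.* j) ≡ + (c ℕ.* ℕGCD.gcd ℤ.∣ i ∣ ℤ.∣ j ∣)
gcd[ci,cj]≡c*gcd[i,j] c i j = P.cong +_ (P.trans (P.cong₂ ℕGCD.gcd (ℤP.abs-* (+ c) i) (ℤP.abs-* (+ c) j))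
                                                 (P.sym (ℕGCD.c*gcd[m,n]≡gcd[cm,cn] c ℤ.∣ i ∣ ℤ.∣ j ∣)))

positive-pairs : ∀ {a} (Q : ℤ → ℤ → Set a) → (∀ m n → Q (+ suc m) (+ suc n)) → ∀ h k → 0ℤ ℤ.< h → 0ℤ ℤ.< k → Q h k
positive-pairs Q Q⁺ (+ suc m) (+ suc n) _          _          = Q⁺ m n
positive-pairs Q Q⁺ (+ zero)  k         (ℤ.+<+ ()) _
positive-pairs Q Q⁺ (+ suc m) (+ zero)  _          (ℤ.+<+ ())

module FieldLemmas {c ℓ} (F : Field c ℓ) where
  open Field F
  open import Algebra.Properties.Ring ring public
    using (-‿involutive; -0#≈0#; -‿distribˡ-*; -‿distribʳ-*; -1*x≈-x; -‿+-comm; x∙y⁻¹≈ε⇒x≈y; x≈y⇒x∙y⁻¹≈ε)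
  import Algebra.Properties.Semiring.Mult semiring as Mult
  import Algebra.Properties.CommutativeSemiring.Exp commutativeSemiring as Exp
  open import Relation.Binary.Reasoning.Setoid setoid

  ιℕ≡×1# : ∀ n → ιℕ n ≡ n Mult.× 1#
  ιℕ≡×1# zero    = P.refl
  ιℕ≡×1# (suc n) = P.cong (λ x → 1# + x) (ιℕ≡×1# n)

  ιℕ-homo-+ : ∀ m n → ιℕ (m ℕ.+ n) ≈ ιℕ m + ιℕ n
  ιℕ-homo-+ m n rewrite ιℕ≡×1# m | ιℕ≡×1# n | ιℕ≡×1# (m ℕ.+ n) = Mult.×-homo-+ 1# m n

  ιℕ-homo-* : ∀ m n → ιℕ (m ℕ.* n) ≈ ιℕ m * ιℕ n
  ιℕ-homo-* m n rewrite ιℕ≡×1# m | ιℕ≡×1# n | ιℕ≡×1# (m ℕ.* n) = Mult.×1-homo-* m n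

  ι-homo-⊖ : ∀ m n → ι (m ℤ.⊖ n) ≈ ιℕ m - ιℕ n
  ι-homo-⊖ zero    zero    = sym (-‿inverseʳ 0#)
  ι-homo-⊖ zero    (suc n) = sym (+-identityˡ _)
  ι-homo-⊖ (suc m) zero    = sym (trans (+-congˡ -0#≈0#) (+-identityʳ _))
  ι-homo-⊖ (suc m) (suc n) = begin
    ι (suc m ℤ.⊖ suc n)            ≡⟨ P.cong ι (ℤP.[1+m]⊖[1+n]≡m⊖n m n) ⟩
    ι (m ℤ.⊖ n)                    ≈⟨ ι-homo-⊖ m n ⟩
    ιℕ m - ιℕ n                    ≈⟨ +-identityˡ _ ⟨
    0# + (ιℕ m - ιℕ n)             ≈⟨ +-congʳ (-‿inverseʳ 1#) ⟨
    (1# - 1#) + (ιℕ m - ιℕ n)      ≈⟨ +-assoc 1# (- 1#) _ ⟩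
    1# + (- 1# + (ιℕ m - ιℕ n))    ≈⟨ +-congˡ (+-assoc (- 1#) (ιℕ m) (- ιℕ n)) ⟨
    1# + ((- 1# + ιℕ m) - ιℕ n)    ≈⟨ +-congˡ (+-congʳ (+-comm (- 1#) (ιℕ m))) ⟩
    1# + ((ιℕ m - 1#) - ιℕ n)      ≈⟨ +-congˡ (+-assoc (ιℕ m) (- 1#) (- ιℕ n)) ⟩
    1# + (ιℕ m + (- 1# - ιℕ n))    ≈⟨ +-assoc 1# (ιℕ m) _ ⟨
    ιℕ (suc m) + (- 1# - ιℕ n)     ≈⟨ +-congˡ (-‿+-comm 1# (ιℕ n)) ⟩
    ιℕ (suc m) - ιℕ (suc n)        ∎

  ι-homo-neg : ∀ i → ι (ℤ.- i) ≈ - ι i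
  ι-homo-neg (+ zero)  = sym -0#≈0#
  ι-homo-neg (+ suc n) = refl
  ι-homo-neg -[1+ n ]  = sym (-‿involutive _)

  ι-homo-+ : ∀ i j → ι (i ℤ.+ j) ≈ ι i + ι j
  ι-homo-+ (+ m)    (+ n)    = ιℕ-homo-+ m n
  ι-homo-+ (+ m)    -[1+ n ] = ι-homo-⊖ m (suc n)
  ι-homo-+ -[1+ m ] (+ n)    = trans (ι-homo-⊖ n (suc m)) (+-comm _ _)
  ι-homo-+ -[1+ m ] -[1+ n ] = begin
    - ιℕ (suc (suc (m ℕ.+ n)))     ≡⟨ P.cong (λ x → - ιℕ (suc x)) (ℕP.+-suc m n) ⟨
    - ιℕ (suc m ℕ.+ suc n)         ≈⟨ -‿cong (ιℕ-homo-+ (suc m) (suc n)) ⟩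
    - (ιℕ (suc m) + ιℕ (suc n))    ≈⟨ -‿+-comm _ _ ⟨
    - ιℕ (suc m) + - ιℕ (suc n)    ∎

  ι-homo-*-pos : ∀ m j → ι (+ m ℤ.* j) ≈ ιℕ m * ι j
  ι-homo-*-pos zero    j = sym (zeroˡ (ι j))
  ι-homo-*-pos (suc m) j = begin
    ι (+ suc m ℤ.* j)             ≡⟨ P.cong ι (ℤP.suc-* (+ m) j) ⟩
    ι (j ℤ.+ + m ℤ.* j)           ≈⟨ ι-homo-+ j (+ m ℤ.* j) ⟩
    ι j + ι (+ m ℤ.* j)           ≈⟨ +-cong (sym (*-identityˡ (ι j))) (ι-homo-*-pos m j) ⟩
    1# * ι j + ιℕ m * ι j         ≈⟨ distribʳ (ι j) 1# (ιℕ m) ⟨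
    ιℕ (suc m) * ι j              ∎

  ι-homo-* : ∀ i j → ι (i ℤ.* j) ≈ ι i * ι j
  ι-homo-* (+ m)    j = ι-homo-*-pos m j
  ι-homo-* -[1+ m ] j = begin
    ι (-[1+ m ] ℤ.* j)            ≡⟨ P.cong ι (ℤP.neg-distribˡ-* (+ suc m) j) ⟨
    ι (ℤ.- (+ suc m ℤ.* j))       ≈⟨ ι-homo-neg (+ suc m ℤ.* j) ⟩
    - ι (+ suc m ℤ.* j)           ≈⟨ -‿cong (ι-homo-*-pos (suc m) j) ⟩
    - (ιℕ (suc m) * ι j)          ≈⟨ -‿distribˡ-* (ιℕ (suc m)) (ι j) ⟩
    - ιℕ (suc m) * ι j            ∎

  ℤ-coefficients : RawRing _ _
  ℤ-coefficients = CommutativeRing.rawRing ℤP.+-*-commutativeRing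

  ι-morphism : ℤ-coefficients ACR.-Raw-AlmostCommutative⟶ ACR.fromCommutativeRing commutativeRing
  ι-morphism = record
    { ⟦_⟧ = ι ; +-homo = ι-homo-+ ; *-homo = ι-homo-* ; -‿homo = ι-homo-neg
    ; 0-homo = refl ; 1-homo = +-identityʳ 1# }

  ι-≟ : ∀ i j → Maybe (ι i ≈ ι j)
  ι-≟ i j with i ℤ.≟ j
  ... | yes i≡j = just (reflexive (P.cong ι i≡j))
  ... | no _    = nothing

  open RingSolver ℤ-coefficients (ACR.fromCommutativeRing commutativeRing) ι-morphism ι-≟ public
    using (solve; _:=_; _:+_; _:*_; :-_; _:-_; con)

  *-⁻¹-cancelˡ : ∀ {a} x → a ≉ 0# → a * (a ⁻¹ * x) ≈ x
  *-⁻¹-cancelˡ {a} x a≉0 = begin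
    a * (a ⁻¹ * x)  ≈⟨ *-assoc a (a ⁻¹) x ⟨
    (a * a ⁻¹) * x  ≈⟨ *-congʳ (⁻¹-inverse a a≉0) ⟩
    1# * x          ≈⟨ *-identityˡ x ⟩
    x               ∎

  *-cancelˡ-≉0 : ∀ {a x y} → a ≉ 0# → a * x ≈ a * y → x ≈ y
  *-cancelˡ-≉0 {a} {x} {y} a≉0 ax≈ay = begin
    x               ≈⟨ *-⁻¹-cancelˡ x a≉0 ⟨
    a * (a ⁻¹ * x)  ≈⟨ *-congˡ (*-comm (a ⁻¹) x) ⟩
    a * (x * a ⁻¹)  ≈⟨ *-assoc a x (a ⁻¹) ⟨
    (a * x) * a ⁻¹  ≈⟨ *-congʳ ax≈ay ⟩
    (a * y) * a ⁻¹  ≈⟨ *-assoc a y (a ⁻¹) ⟩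
    a * (y * a ⁻¹)  ≈⟨ *-congˡ (*-comm y (a ⁻¹)) ⟩
    a * (a ⁻¹ * y)  ≈⟨ *-⁻¹-cancelˡ y a≉0 ⟩
    y               ∎

  *≈0⇒≈0 : ∀ {a b} → a ≉ 0# → a * b ≈ 0# → b ≈ 0#
  *≈0⇒≈0 {a} a≉0 ab≈0 = *-cancelˡ-≉0 a≉0 (trans ab≈0 (sym (zeroʳ a)))

  *-≉0 : ∀ {a b} → a ≉ 0# → b ≉ 0# → a * b ≉ 0#
  *-≉0 a≉0 b≉0 ab≈0 = b≉0 (*≈0⇒≈0 a≉0 ab≈0)

  -‿≉0 : ∀ {a} → a ≉ 0# → - a ≉ 0#
  -‿≉0 {a} a≉0 -a≈0 = a≉0 (trans (sym (-‿involutive a)) (trans (-‿cong -a≈0) -0#≈0#))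

  x+x≈0⇒x≈0 : ∀ x → x + x ≈ 0# → x ≈ 0#
  x+x≈0⇒x≈0 x x+x≈0 = *≈0⇒≈0 (char0 1) (trans (solve 1 (λ x → con (+ 2) :* x := x :+ x) refl x) x+x≈0)

  c*[x-y]≈0 : ∀ c {x y} → x ≈ y → c * (x - y) ≈ 0#
  c*[x-y]≈0 c x≈y = trans (*-congˡ (x≈y⇒x∙y⁻¹≈ε x≈y)) (zeroʳ c)

  ≈-by-combination₃ : ∀ {L R A₁ B₁ A₂ B₂ A₃ B₃} c₁ c₂ c₃ → A₁ ≈ B₁ → A₂ ≈ B₂ → A₃ ≈ B₃ →
    L - R ≈ c₁ * (A₁ - B₁) + c₂ * (A₂ - B₂) + c₃ * (A₃ - B₃) → L ≈ R
  ≈-by-combination₃ c₁ c₂ c₃ e₁ e₂ e₃ L-R≈ = x∙y⁻¹≈ε⇒x≈y _ _ (trans L-R≈ (trans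
    (+-cong (+-cong (c*[x-y]≈0 c₁ e₁) (c*[x-y]≈0 c₂ e₂)) (c*[x-y]≈0 c₃ e₃))
    (trans (+-identityʳ _) (+-identityʳ 0#))))

  ≈-by-combination₄ : ∀ {L R A₁ B₁ A₂ B₂ A₃ B₃ A₄ B₄} c₁ c₂ c₃ c₄ → A₁ ≈ B₁ → A₂ ≈ B₂ → A₃ ≈ B₃ → A₄ ≈ B₄ →
    L - R ≈ c₁ * (A₁ - B₁) + c₂ * (A₂ - B₂) + c₃ * (A₃ - B₃) + c₄ * (A₄ - B₄) → L ≈ R
  ≈-by-combination₄ c₁ c₂ c₃ c₄ e₁ e₂ e₃ e₄ L-R≈ =
    ≈-by-combination₃ c₁ c₂ c₃ e₁ e₂ e₃ (trans L-R≈ (trans (+-congˡ (c*[x-y]≈0 c₄ e₄)) (+-identityʳ _)))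

  ^≡^ : ∀ x n → x ^ n ≡ x Exp.^ n
  ^≡^ x zero    = P.refl
  ^≡^ x (suc n) = P.cong (x *_) (^≡^ x n)

  ^-congˡ : ∀ n {x y} → x ≈ y → x ^ n ≈ y ^ n
  ^-congˡ n {x} {y} rewrite ^≡^ x n | ^≡^ y n = Exp.^-congˡ n

  ^-homo-* : ∀ x m n → x ^ (m ℕ.+ n) ≈ x ^ m * x ^ n
  ^-homo-* x m n rewrite ^≡^ x m | ^≡^ x n | ^≡^ x (m ℕ.+ n) = Exp.^-homo-* x m n

  ^-distrib-* : ∀ x y n → (x * y) ^ n ≈ x ^ n * y ^ n
  ^-distrib-* x y n rewrite ^≡^ x n | ^≡^ y n | ^≡^ (x * y) n = Exp.^-distrib-* x y n

  1#^n≈1# : ∀ n → 1# ^ n ≈ 1#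
  1#^n≈1# zero    = refl
  1#^n≈1# (suc n) = trans (*-identityˡ _) (1#^n≈1# n)

  -1#^[n+n]≈1# : ∀ n → (- 1#) ^ (n ℕ.+ n) ≈ 1#
  -1#^[n+n]≈1# n = begin
    (- 1#) ^ (n ℕ.+ n)            ≈⟨ ^-homo-* (- 1#) n n ⟩
    (- 1#) ^ n * (- 1#) ^ n       ≈⟨ ^-distrib-* (- 1#) (- 1#) n ⟨
    (- 1# * - 1#) ^ n             ≈⟨ ^-congˡ n (trans (-1*x≈-x (- 1#)) (-‿involutive 1#)) ⟩
    1# ^ n                        ≈⟨ 1#^n≈1# n ⟩
    1#                            ∎

  -1#^even≈1# : ∀ {n} → 2 ∣ n → (- 1#) ^ n ≈ 1#
  -1#^even≈1# {n} (ℕDiv.divides q n≡q*2) = begin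
    (- 1#) ^ n            ≡⟨ P.cong ((- 1#) ^_) (P.trans n≡q*2 (P.trans (ℕP.*-comm q 2) (P.cong (q ℕ.+_) (ℕP.+-identityʳ q)))) ⟩
    (- 1#) ^ (q ℕ.+ q)    ≈⟨ -1#^[n+n]≈1# q ⟩
    1#                    ∎

  ιℕ-homo-^ : ∀ m n → ιℕ (m ℕ.^ n) ≈ ιℕ m ^ n
  ιℕ-homo-^ m zero    = +-identityʳ 1#
  ιℕ-homo-^ m (suc n) = trans (ιℕ-homo-* m (m ℕ.^ n)) (*-congˡ (ιℕ-homo-^ m n))

  ιℕ-*-cancel-< : ∀ {m n} K → m ℕ.< n → ιℕ m * K ≈ ιℕ n * K → K ≈ 0#
  ιℕ-*-cancel-< {m} {n} K m<n mK≈nK with ℕP.m≤n⇒∃[o]m+o≡n m<n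
  ... | o , m+o≡n = *≈0⇒≈0 (char0 o) (begin
    ιℕ (suc o) * K                        ≈⟨ solve 3 (λ x y z → y :* z := (x :+ y) :* z :- x :* z) refl (ιℕ m) (ιℕ (suc o)) K ⟩
    (ιℕ m + ιℕ (suc o)) * K - ιℕ m * K    ≈⟨ +-cong (*-congʳ (ιℕ-homo-+ m (suc o))) (-‿cong (sym mK≈nK)) ⟨
    ιℕ (m ℕ.+ suc o) * K - ιℕ n * K       ≡⟨ P.cong (λ k → ιℕ k * K - ιℕ n * K) (P.trans (ℕP.+-suc m o) m+o≡n) ⟩
    ιℕ n * K - ιℕ n * K                   ≈⟨ -‿inverseʳ _ ⟩
    0#                                    ∎)

  ιℕ[m+n]-ιℕ[n]≈ιℕ[m] : ∀ m n → ιℕ (m ℕ.+ n) - ιℕ n ≈ ιℕ m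
  ιℕ[m+n]-ιℕ[n]≈ιℕ[m] m n = trans (+-congʳ (ιℕ-homo-+ m n)) (solve 2 (λ x y → (x :+ y) :- y := x) refl (ιℕ m) (ιℕ n))

module PolynomialFunctions {c ℓ} (F : Field c ℓ) where
  open Field F
  open FieldLemmas F
  open import Relation.Binary.Reasoning.Setoid setoid

  IsPoly : ℕ → (Carrier → Carrier) → Set (c ⊔ ℓ)
  IsPoly zero    p = ∀ t → p t ≈ 0#
  IsPoly (suc n) p = Σ Carrier λ a → Σ (Carrier → Carrier) λ q → IsPoly n q × (∀ t → p t ≈ a + t * q t)

  IsPoly-cong : ∀ n {p q} → IsPoly n p → (∀ t → p t ≈ q t) → IsPoly n q
  IsPoly-cong zero    p≈0 p≈q t = trans (sym (p≈q t)) (p≈0 t)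
  IsPoly-cong (suc n) (a , r , r-poly , p≈) p≈q = a , r , r-poly , λ t → trans (sym (p≈q t)) (p≈ t)

  IsPoly-0 : ∀ n → IsPoly n (λ _ → 0#)
  IsPoly-0 zero    t = refl
  IsPoly-0 (suc n) = 0# , (λ _ → 0#) , IsPoly-0 n , λ t → sym (trans (+-identityˡ _) (zeroʳ t))

  IsPoly-suc : ∀ n {p} → IsPoly n p → IsPoly (suc n) p
  IsPoly-suc zero    p≈0                  = 0# , (λ _ → 0#) , IsPoly-0 0 , λ t → trans (p≈0 t) (sym (trans (+-identityˡ _) (zeroʳ t)))
  IsPoly-suc (suc n) (a , q , q-poly , p≈) = a , q , IsPoly-suc n q-poly , p≈

  IsPoly-≤ : ∀ {m n p} → m ℕ.≤ n → IsPoly m p → IsPoly n p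
  IsPoly-≤ m≤n = go (ℕP.≤⇒≤′ m≤n)
    where
    go : ∀ {m n p} → m ℕ.≤′ n → IsPoly m p → IsPoly n p
    go ℕ.≤′-refl         p-poly = p-poly
    go (ℕ.≤′-step {n} le) p-poly = IsPoly-suc n (go le p-poly)

  IsPoly-+ : ∀ n {p q} → IsPoly n p → IsPoly n q → IsPoly n (λ t → p t + q t)
  IsPoly-+ zero    p≈0 q≈0 t = trans (+-cong (p≈0 t) (q≈0 t)) (+-identityˡ 0#)
  IsPoly-+ (suc n) (a , p′ , p′-poly , p≈) (b , q′ , q′-poly , q≈) =
    a + b , (λ t → p′ t + q′ t) , IsPoly-+ n p′-poly q′-poly ,
    λ t → trans (+-cong (p≈ t) (q≈ t))
                (solve 5 (λ a b t x y → (a :+ t :* x) :+ (b :+ t :* y) := (a :+ b) :+ t :* (x :+ y)) refl a b t (p′ t) (q′ t))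

  IsPoly-*ˡ : ∀ n k {p} → IsPoly n p → IsPoly n (λ t → k * p t)
  IsPoly-*ˡ zero    k p≈0 t = trans (*-congˡ (p≈0 t)) (zeroʳ k)
  IsPoly-*ˡ (suc n) k (a , p′ , p′-poly , p≈) =
    k * a , (λ t → k * p′ t) , IsPoly-*ˡ n k p′-poly ,
    λ t → trans (*-congˡ (p≈ t)) (solve 4 (λ k a t x → k :* (a :+ t :* x) := k :* a :+ t :* (k :* x)) refl k a t (p′ t))

  IsPoly-^ : ∀ m → IsPoly (suc m) (_^ m)
  IsPoly-^ zero    = 1# , (λ _ → 0#) , IsPoly-0 0 , λ t → sym (trans (+-congˡ (zeroʳ t)) (+-identityʳ 1#))
  IsPoly-^ (suc m) = 0# , (_^ m) , IsPoly-^ m , λ t → sym (+-identityˡ _)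

  IsPoly-sumFin : ∀ n k (f : Fin k → Carrier → Carrier) → (∀ i → IsPoly n (f i)) → IsPoly n (λ t → sumFin k (λ i → f i t))
  IsPoly-sumFin n zero    f f-poly = IsPoly-0 n
  IsPoly-sumFin n (suc k) f f-poly = IsPoly-+ n (f-poly Fin.zero) (IsPoly-sumFin n k (λ i → f (Fin.suc i)) (λ i → f-poly (Fin.suc i)))

  factor-theorem : ∀ n {p} → IsPoly (suc n) p → ∀ r →
    Σ (Carrier → Carrier) λ q → IsPoly n q × (∀ t → p t - p r ≈ (t - r) * q t)
  factor-theorem zero {p} (a , q , q≈0 , p≈) r = (λ _ → 0#) , (λ _ → refl) , λ t → begin
    p t - p r                        ≈⟨ +-cong (p≈ t) (-‿cong (p≈ r)) ⟩
    (a + t * q t) - (a + r * q r)    ≈⟨ +-cong (+-congˡ (*-congˡ (q≈0 t))) (-‿cong (+-congˡ (*-congˡ (q≈0 r)))) ⟩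
    (a + t * 0#) - (a + r * 0#)      ≈⟨ solve 3 (λ a t r → (a :+ t :* con 0ℤ) :- (a :+ r :* con 0ℤ) := (t :- r) :* con 0ℤ) refl a t r ⟩
    (t - r) * 0#                     ∎
  factor-theorem (suc n) {p} (a , q , q-poly , p≈) r with factor-theorem n q-poly r
  ... | q′ , q′-poly , q-factor = (λ t → q t + r * q′ t) , IsPoly-+ (suc n) q-poly (IsPoly-*ˡ (suc n) r (IsPoly-suc n q′-poly)) , λ t → begin
    p t - p r                                ≈⟨ +-cong (p≈ t) (-‿cong (p≈ r)) ⟩
    (a + t * q t) - (a + r * q r)
      ≈⟨ solve 5 (λ a t r x y → (a :+ t :* x) :- (a :+ r :* y) := (t :- r) :* x :+ r :* (x :- y)) refl a t r (q t) (q r) ⟩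
    (t - r) * q t + r * (q t - q r)          ≈⟨ +-congˡ (*-congˡ (q-factor t)) ⟩
    (t - r) * q t + r * ((t - r) * q′ t)
      ≈⟨ solve 4 (λ t r x y → (t :- r) :* x :+ r :* ((t :- r) :* y) := (t :- r) :* (x :+ r :* y)) refl t r (q t) (q′ t) ⟩
    (t - r) * (q t + r * q′ t)               ∎

  -- In characteristic 0 the naturals m, m+1, … are infinitely many distinct roots.
  IsPoly-vanishing : ∀ n {p} → IsPoly n p → ∀ m → (∀ j → p (ιℕ (m ℕ.+ j)) ≈ 0#) → ∀ t → p t ≈ 0#
  IsPoly-vanishing zero    p≈0 m vanishes t = p≈0 t
  IsPoly-vanishing (suc n) {p} p-poly m vanishes t with factor-theorem n p-poly (ιℕ m)
  ... | q , q-poly , p-factor = begin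
    p t                           ≈⟨ x∙y⁻¹≈ε⇒x≈y _ _ (trans (p-factor t) (trans (*-congˡ (q≈0 t)) (zeroʳ _))) ⟩
    p (ιℕ m)                      ≈⟨ pm≈0 ⟩
    0#                            ∎
    where
    pm≈0 : p (ιℕ m) ≈ 0#
    pm≈0 = trans (reflexive (P.cong (λ k → p (ιℕ k)) (P.sym (ℕP.+-identityʳ m)))) (vanishes 0)
    q-vanishes : ∀ j → q (ιℕ (suc m ℕ.+ j)) ≈ 0#
    q-vanishes j = *≈0⇒≈0 (char0 j) (begin
      ιℕ (suc j) * q x                     ≈⟨ *-congʳ (ιℕ[m+n]-ιℕ[n]≈ιℕ[m] (suc j) m) ⟨
      (ιℕ (suc j ℕ.+ m) - ιℕ m) * q x      ≡⟨ P.cong (λ k → (ιℕ k - ιℕ m) * q x) (P.trans (ℕP.+-comm (suc j) m) m+[1+j]≡1+m+j) ⟩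
      (x - ιℕ m) * q x                     ≈⟨ p-factor x ⟨
      p x - p (ιℕ m)                       ≈⟨ +-cong px≈0 (-‿cong pm≈0) ⟩
      0# - 0#                              ≈⟨ -‿inverseʳ 0# ⟩
      0#                                   ∎)
      where
      x = ιℕ (suc m ℕ.+ j)
      m+[1+j]≡1+m+j : m ℕ.+ suc j ≡ suc m ℕ.+ j
      m+[1+j]≡1+m+j = ℕP.+-suc m j
      px≈0 : p x ≈ 0#
      px≈0 = trans (reflexive (P.cong (λ k → p (ιℕ k)) (P.sym m+[1+j]≡1+m+j))) (vanishes (suc j))
    q≈0 : ∀ t → q t ≈ 0#
    q≈0 = IsPoly-vanishing n q-poly (suc m) q-vanishes

module HomogeneousForms {c ℓ} (F : Field c ℓ) where
  open Field F
  open FieldLemmas F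
  open PolynomialFunctions F
  import Algebra.Properties.Semiring.Sum semiring as Sum
  import Data.Fin.Properties as FinP
  open import Relation.Binary.Reasoning.Setoid setoid

  sumFin≡sum : ∀ n (f : Fin n → Carrier) → sumFin n f ≡ Sum.sum f
  sumFin≡sum zero    f = P.refl
  sumFin≡sum (suc n) f = P.cong (λ s → f Fin.zero + s) (sumFin≡sum n (λ i → f (Fin.suc i)))

  sumFin-cong : ∀ n {f g : Fin n → Carrier} → (∀ i → f i ≈ g i) → sumFin n f ≈ sumFin n g
  sumFin-cong n {f} {g} f≈g rewrite sumFin≡sum n f | sumFin≡sum n g = Sum.sum-cong-≋ f≈g

  *-distribˡ-sumFin : ∀ n x (f : Fin n → Carrier) → x * sumFin n f ≈ sumFin n (λ i → x * f i)
  *-distribˡ-sumFin n x f rewrite sumFin≡sum n f | sumFin≡sum n (λ i → x * f i) = Sum.*-distribˡ-sum x f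

  monomial : ∀ {d} → Carrier → Carrier → Fin (suc d) → Carrier
  monomial {d} x y i = x ^ toℕ i * y ^ (d ℕ.∸ toℕ i)

  module _ {d : ℕ} (a : HomPoly F d) where

    evalK-cong : ∀ {x x′ y y′} → x ≈ x′ → y ≈ y′ → evalK F a x y ≈ evalK F a x′ y′
    evalK-cong {x} {x′} {y} {y′} x≈x′ y≈y′ = sumFin-cong (suc d) term
      where
      term : ∀ i → a i * monomial x y i ≈ a i * monomial {d} x′ y′ i
      term i = *-congˡ (*-cong (^-congˡ (toℕ i) x≈x′) (^-congˡ (d ℕ.∸ toℕ i) y≈y′))

    evalK-homogeneous : ∀ t x y → evalK F a (t * x) (t * y) ≈ t ^ d * evalK F a x y
    evalK-homogeneous t x y = trans (sumFin-cong (suc d) term) (sym (*-distribˡ-sumFin (suc d) (t ^ d) (λ i → a i * monomial x y i)))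
      where
      term : ∀ i → a i * monomial (t * x) (t * y) i ≈ t ^ d * (a i * monomial x y i)
      term i = begin
        a i * ((t * x) ^ k * (t * y) ^ (d ℕ.∸ k))               ≈⟨ *-congˡ (*-cong (^-distrib-* t x k) (^-distrib-* t y (d ℕ.∸ k))) ⟩
        a i * ((t ^ k * x ^ k) * (t ^ (d ℕ.∸ k) * y ^ (d ℕ.∸ k)))
          ≈⟨ solve 5 (λ a tk xk tl yl → a :* ((tk :* xk) :* (tl :* yl)) := (tk :* tl) :* (a :* (xk :* yl))) refl (a i) (t ^ k) (x ^ k) (t ^ (d ℕ.∸ k)) (y ^ (d ℕ.∸ k)) ⟩
        (t ^ k * t ^ (d ℕ.∸ k)) * (a i * (x ^ k * y ^ (d ℕ.∸ k))) ≈⟨ *-congʳ (^-homo-* t k (d ℕ.∸ k)) ⟨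
        t ^ (k ℕ.+ (d ℕ.∸ k)) * (a i * (x ^ k * y ^ (d ℕ.∸ k)))
          ≡⟨ P.cong (λ n → t ^ n * (a i * (x ^ k * y ^ (d ℕ.∸ k)))) (ℕP.m+[n∸m]≡n (FinP.toℕ≤pred[n] i)) ⟩
        t ^ d * (a i * (x ^ k * y ^ (d ℕ.∸ k)))                   ∎
        where k = toℕ i

    evalK-neg : (- 1#) ^ d ≈ 1# → ∀ x y → evalK F a (- x) (- y) ≈ evalK F a x y
    evalK-neg [-1]^d≈1 x y = begin
      evalK F a (- x) (- y)            ≈⟨ evalK-cong (sym (-1*x≈-x x)) (sym (-1*x≈-x y)) ⟩
      evalK F a (- 1# * x) (- 1# * y)  ≈⟨ evalK-homogeneous (- 1#) x y ⟩
      (- 1#) ^ d * evalK F a x y       ≈⟨ *-congʳ [-1]^d≈1 ⟩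
      1# * evalK F a x y               ≈⟨ *-identityˡ _ ⟩
      evalK F a x y                    ∎

    IsPoly-evalKˡ : ∀ y → IsPoly (suc d) (λ t → evalK F a t y)
    IsPoly-evalKˡ y = IsPoly-sumFin (suc d) (suc d) _ λ i →
      IsPoly-cong (suc d) (IsPoly-*ˡ (suc d) (a i * y ^ (d ℕ.∸ toℕ i)) (IsPoly-≤ (FinP.toℕ<n i) (IsPoly-^ (toℕ i))))
        (λ t → solve 3 (λ a y′ t′ → (a :* y′) :* t′ := a :* (t′ :* y′)) refl (a i) (y ^ (d ℕ.∸ toℕ i)) (t ^ toℕ i))

    IsPoly-evalKʳ : ∀ x α → IsPoly (suc d) (λ t → evalK F a x (α * t))
    IsPoly-evalKʳ x α = IsPoly-sumFin (suc d) (suc d) _ λ i →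
      IsPoly-cong (suc d) (IsPoly-*ˡ (suc d) (a i * x ^ toℕ i * α ^ (d ℕ.∸ toℕ i)) (IsPoly-≤ (ℕ.s≤s (ℕP.m∸n≤m d (toℕ i))) (IsPoly-^ (d ℕ.∸ toℕ i))))
        (λ t → trans (solve 4 (λ a x′ α′ t′ → (a :* x′ :* α′) :* t′ := a :* (x′ :* (α′ :* t′))) refl (a i) (x ^ toℕ i) (α ^ (d ℕ.∸ toℕ i)) (t ^ (d ℕ.∸ toℕ i)))
                     (*-congˡ (*-congˡ (sym (^-distrib-* α t (d ℕ.∸ toℕ i))))))

  evalK-zero : ∀ {d} x y → evalK F {d} (λ _ → 0#) x y ≈ 0#
  evalK-zero {d} x y = begin
    sumFin (suc d) (λ i → 0# * monomial {d} x y i)  ≈⟨ *-distribˡ-sumFin (suc d) 0# (monomial x y) ⟨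
    0# * sumFin (suc d) (monomial x y)              ≈⟨ zeroˡ _ ⟩
    0#                                              ∎

  -- Φ(t,1) = K tᵉ forces Φ(x,y) = K xᵉ yᵈ⁻ᵉ, so Φ(1,2) = 2ᵈ⁻ᵉ K, which differs from 2ᵉ K when 2e < d.
  dehomogenised-monomial≈0 : ∀ d e (Φ : Carrier → Carrier → Carrier) K →
    (∀ {x x′ y y′} → x ≈ x′ → y ≈ y′ → Φ x y ≈ Φ x′ y′) →
    (∀ x y → Φ (ιℕ 2 * x) (ιℕ 2 * y) ≈ ιℕ 2 ^ d * Φ x y) →
    IsPoly (suc d) (λ t → Φ t (ιℕ 1)) →
    e ℕ.+ e ℕ.< d →
    (∀ j → Φ (ιℕ (suc j)) (ιℕ 1) ≈ ιℕ (suc j) ^ e * K) →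
    Φ (ιℕ 1) (ιℕ 2) ≈ ιℕ 2 ^ e * K →
    K ≈ 0#
  dehomogenised-monomial≈0 d e Φ K Φ-cong Φ-homogeneous Φ-poly 2e<d Φ[j,1] Φ[1,2] =
    ιℕ-*-cancel-< K (ℕP.^-monoʳ-< 2 (ℕ.s≤s (ℕ.s≤s ℕ.z≤n)) 2e<d) 2²ᵉK≈2ᵈK
    where
    two = ιℕ 2
    half = two ⁻¹
    two*half≈1 : two * half ≈ 1#
    two*half≈1 = ⁻¹-inverse two (char0 1)
    Ψ : Carrier → Carrier
    Ψ t = Φ t (ιℕ 1) + (- K) * t ^ e
    Ψ≈0 : ∀ t → Ψ t ≈ 0#
    Ψ≈0 = IsPoly-vanishing (suc d)
      (IsPoly-+ (suc d) Φ-poly (IsPoly-*ˡ (suc d) (- K) (IsPoly-≤ (ℕ.s≤s (ℕP.≤-trans (ℕP.m≤m+n e e) (ℕP.<⇒≤ 2e<d))) (IsPoly-^ e))))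
      1 (λ j → trans (+-congʳ (Φ[j,1] j)) (solve 2 (λ x k → x :* k :+ (:- k) :* x := con 0ℤ) refl (ιℕ (suc j) ^ e) K))
    Φ[half,1] : Φ half (ιℕ 1) ≈ half ^ e * K
    Φ[half,1] = x∙y⁻¹≈ε⇒x≈y _ _ (trans (solve 3 (λ a b k → a :- b :* k := a :+ (:- k) :* b) refl (Φ half (ιℕ 1)) (half ^ e) K) (Ψ≈0 half))
    2ᵈ2⁻ᵉK≈2ᵉK : two ^ d * (half ^ e * K) ≈ two ^ e * K
    2ᵈ2⁻ᵉK≈2ᵉK = begin
      two ^ d * (half ^ e * K)      ≈⟨ *-congˡ Φ[half,1] ⟨
      two ^ d * Φ half (ιℕ 1)       ≈⟨ Φ-homogeneous half (ιℕ 1) ⟨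
      Φ (two * half) (two * ιℕ 1)   ≈⟨ Φ-cong (trans two*half≈1 (sym (+-identityʳ 1#))) (trans (*-congˡ (+-identityʳ 1#)) (*-identityʳ two)) ⟩
      Φ (ιℕ 1) two                  ≈⟨ Φ[1,2] ⟩
      two ^ e * K                   ∎
    2²ᵉK≈2ᵈK : ιℕ (2 ℕ.^ (e ℕ.+ e)) * K ≈ ιℕ (2 ℕ.^ d) * K
    2²ᵉK≈2ᵈK = begin
      ιℕ (2 ℕ.^ (e ℕ.+ e)) * K                  ≈⟨ *-congʳ (trans (ιℕ-homo-^ 2 (e ℕ.+ e)) (^-homo-* two e e)) ⟩
      (two ^ e * two ^ e) * K                   ≈⟨ *-assoc _ _ _ ⟩
      two ^ e * (two ^ e * K)                   ≈⟨ *-congˡ 2ᵈ2⁻ᵉK≈2ᵉK ⟨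
      two ^ e * (two ^ d * (half ^ e * K))
        ≈⟨ solve 4 (λ a b c k → a :* (b :* (c :* k)) := b :* ((a :* c) :* k)) refl (two ^ e) (two ^ d) (half ^ e) K ⟩
      two ^ d * ((two ^ e * half ^ e) * K)
        ≈⟨ *-congˡ (*-congʳ (trans (sym (^-distrib-* two half e)) (trans (^-congˡ e two*half≈1) (1#^n≈1# e))) ) ⟩
      two ^ d * (1# * K)                        ≈⟨ *-congˡ (*-identityˡ K) ⟩
      two ^ d * K                               ≈⟨ *-congʳ (ιℕ-homo-^ 2 d) ⟨
      ιℕ (2 ℕ.^ d) * K                          ∎

  constant-on-rays⇒≈0 : ∀ d (Φ : Carrier → Carrier → Carrier) K →
    (∀ {x x′ y y′} → x ≈ x′ → y ≈ y′ → Φ x y ≈ Φ x′ y′) →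
    (∀ x y → Φ (ιℕ 2 * x) (ιℕ 2 * y) ≈ ιℕ 2 ^ d * Φ x y) →
    IsPoly (suc d) (λ t → Φ t (ιℕ 1)) →
    0 ℕ.< d →
    (∀ j → Φ (ιℕ (suc j)) (ιℕ 1) ≈ K) →
    Φ (ιℕ 1) (ιℕ 2) ≈ K →
    K ≈ 0#
  constant-on-rays⇒≈0 d Φ K Φ-cong Φ-homogeneous Φ-poly 0<d Φ[j,1] Φ[1,2] =
    dehomogenised-monomial≈0 d 0 Φ K Φ-cong Φ-homogeneous Φ-poly 0<d
      (λ j → trans (Φ[j,1] j) (sym (*-identityˡ K))) (trans Φ[1,2] (sym (*-identityˡ K)))

module FormsInU {c ℓ} (F : Field c ℓ) {w : ℕ} (g : HomPoly F (w ℕ.+ 2)) (g∈U : InU F w g) where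
  open Field F
  open FieldLemmas F
  open PolynomialFunctions F
  open HomogeneousForms F
  open import Relation.Binary.Reasoning.Setoid setoid

  d : ℕ
  d = w ℕ.+ 2

  f : Carrier → Carrier → Carrier
  f = evalK F g

  f-cong : ∀ {x x′ y y′} → x ≈ x′ → y ≈ y′ → f x y ≈ f x′ y′
  f-cong = evalK-cong g

  FSymmetric FParity FShiftedSymmetric : Carrier → Set ℓ
  FSymmetric σ        = ∀ a b → f (ιℕ (suc b)) (ιℕ (suc a)) ≈ σ * f (ιℕ (suc a)) (ιℕ (suc b))
  FParity σ           = ∀ a b → f (ιℕ (suc a)) (- ιℕ (suc b)) ≈ σ * f (ιℕ (suc a)) (ιℕ (suc b))
  FShiftedSymmetric σ = ∀ a b → f (ιℕ (suc a ℕ.+ suc b)) (ιℕ (suc a)) ≈ σ * f (ιℕ (suc a)) (ιℕ (suc a ℕ.+ suc b))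

  U-relation : ∀ {x y z} → x + y ≈ z → x * f z y + y * f x z ≈ z * f x y
  U-relation {x} {y} {z} x+y≈z = begin
    x * f z y + y * f x z              ≈⟨ +-cong (*-congˡ (f-cong (sym x+y≈z) refl)) (*-congˡ (f-cong refl (sym x+y≈z))) ⟩
    x * f (x + y) y + y * f x (x + y)  ≈⟨ g∈U x y ⟩
    (x + y) * f x y                    ≈⟨ *-congʳ x+y≈z ⟩
    z * f x y                          ∎

  U-relation-ℕ : ∀ a b → ιℕ a * f (ιℕ (a ℕ.+ b)) (ιℕ b) + ιℕ b * f (ιℕ a) (ιℕ (a ℕ.+ b)) ≈ ιℕ (a ℕ.+ b) * f (ιℕ a) (ιℕ b)
  U-relation-ℕ a b = U-relation (sym (ιℕ-homo-+ a b))

  f-neg-swap : (- 1#) ^ d ≈ 1# → ∀ x y → f (- x) y ≈ f x (- y)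
  f-neg-swap [-1]^d≈1 x y = trans (f-cong refl (sym (-‿involutive y))) (evalK-neg g [-1]^d≈1 x (- y))

  -- D measures the failure of parity; the U-relation makes D(a,b)/(ab) invariant under both
  -- Euclid moves, and homogeneity with the scaling argument kills it on the diagonal.
  module Symmetric⇒Parity (s : Carrier) (s*s≈1 : s * s ≈ 1#) ([-1]^d≈1 : (- 1#) ^ d ≈ 1#) (1≤w : 1 ℕ.≤ w)
      (f-sym : FSymmetric s) where

    D : ℕ → ℕ → Carrier
    D a b = f (ιℕ a) (- ιℕ b) - s * f (ιℕ a) (ιℕ b)

    D-left : ∀ a b → ιℕ (suc a) * D (suc a ℕ.+ suc b) (suc b) ≈ ιℕ (suc a ℕ.+ suc b) * D (suc a) (suc b)
    D-left a b = ≈-by-combination₃ (ι (ℤ.- 1ℤ)) (- s) (- B) U₁ U₂ (f-sym a (a ℕ.+ suc b))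
      (solve 10 (λ A B S s X₁ X₂ Y₁ Y₂ Z W →
          A :* (X₁ :- s :* X₂) :- S :* (Y₁ :- s :* Y₂)
        := con (ℤ.- 1ℤ) :* ((S :* Y₁ :+ (:- B) :* W) :- A :* X₁) :+ (:- s) :* ((A :* X₂ :+ B :* Z) :- S :* Y₂) :+ (:- B) :* (W :- s :* Z))
        refl A B S s (f S (- B)) (f S B) (f A (- B)) (f A B) (f A S) (f S A))
      where
      A = ιℕ (suc a)
      B = ιℕ (suc b)
      S = ιℕ (suc a ℕ.+ suc b)
      U₁ : S * f A (- B) + (- B) * f S A ≈ A * f S (- B)
      U₁ = U-relation (ιℕ[m+n]-ιℕ[n]≈ιℕ[m] (suc a) (suc b))
      U₂ : A * f S B + B * f A S ≈ S * f A B
      U₂ = U-relation-ℕ (suc a) (suc b)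

    D-right : ∀ a b → ιℕ (suc b) * D (suc a) (suc a ℕ.+ suc b) ≈ ιℕ (suc a ℕ.+ suc b) * D (suc a) (suc b)
    D-right a b = ≈-by-combination₄ (ι (ℤ.- 1ℤ)) (- s) (s * A) (A * f B S) U₁ U₂ (f-sym b (a ℕ.+ suc b)) (trans s*s≈1 (sym (+-identityʳ 1#)))
      (solve 10 (λ B A S s X₁ X₂ Y₁ Y₂ Z W →
          B :* (X₁ :- s :* X₂) :- S :* (Y₁ :- s :* Y₂)
        := con (ℤ.- 1ℤ) :* (((:- A) :* Z :+ S :* Y₁) :- B :* X₁) :+ (:- s) :* ((A :* W :+ B :* X₂) :- S :* Y₂)
           :+ (s :* A) :* (W :- s :* Z) :+ (A :* Z) :* (s :* s :- con 1ℤ))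
        refl B A S s (f A (- S)) (f A S) (f A (- B)) (f A B) (f B S) (f S B))
      where
      A = ιℕ (suc a)
      B = ιℕ (suc b)
      S = ιℕ (suc a ℕ.+ suc b)
      U₁ : (- A) * f B S + S * f A (- B) ≈ B * f A (- S)
      U₁ = begin
        (- A) * f B S + S * f A (- B)      ≈⟨ +-congˡ (*-congˡ (f-neg-swap [-1]^d≈1 A B)) ⟨
        (- A) * f B S + S * f (- A) B      ≈⟨ U-relation (trans (+-comm (- A) S) (S-A≈B)) ⟩
        B * f (- A) S                      ≈⟨ *-congˡ (f-neg-swap [-1]^d≈1 A S) ⟩
        B * f A (- S)                      ∎
        where
        S-A≈B : S - A ≈ B
        S-A≈B = trans (+-congʳ (reflexive (P.cong ιℕ (ℕP.+-comm (suc a) (suc b))))) (ιℕ[m+n]-ιℕ[n]≈ιℕ[m] (suc b) (suc a))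
      U₂ : A * f S B + B * f A S ≈ S * f A B
      U₂ = U-relation-ℕ (suc a) (suc b)

    D-homogeneous : ∀ t x y → f (t * x) (- (t * y)) - s * f (t * x) (t * y) ≈ t ^ d * (f x (- y) - s * f x y)
    D-homogeneous t x y = begin
      f (t * x) (- (t * y)) - s * f (t * x) (t * y)  ≈⟨ +-cong (trans (f-cong refl (-‿distribʳ-* t y)) (evalK-homogeneous g t x (- y)))
                                                                (-‿cong (*-congˡ (evalK-homogeneous g t x y))) ⟩
      t ^ d * f x (- y) - s * (t ^ d * f x y)
        ≈⟨ solve 4 (λ t x s y → t :* x :- s :* (t :* y) := t :* (x :- s :* y)) refl (t ^ d) (f x (- y)) s (f x y) ⟩
      t ^ d * (f x (- y) - s * f x y)                ∎

    D-diagonal : ∀ a → D (suc a) (suc a) ≈ ιℕ (suc a) ^ d * D 1 1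
    D-diagonal a = trans (+-cong (f-cong A≈A*1 (-‿cong A≈A*1))
                                 (-‿cong (*-congˡ (f-cong A≈A*1 A≈A*1))))
                         (D-homogeneous A (ιℕ 1) (ιℕ 1))
      where
      A = ιℕ (suc a)
      A≈A*1 : A ≈ A * ιℕ 1
      A≈A*1 = sym (trans (*-congˡ (+-identityʳ 1#)) (*-identityʳ A))

    D[n,1] : ∀ n → D (suc n) 1 ≈ ιℕ (suc n) * D 1 1
    D[n,1] zero    = sym (trans (*-congʳ (+-identityʳ 1#)) (*-identityˡ _))
    D[n,1] (suc n) = *-cancelˡ-≉0 (char0 n) (begin
      ιℕ (suc n) * D (suc (suc n)) 1                 ≡⟨ P.cong (λ k → ιℕ (suc n) * D k 1) (P.cong suc (ℕP.+-comm 1 n)) ⟩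
      ιℕ (suc n) * D (suc n ℕ.+ 1) 1                 ≈⟨ D-left n 0 ⟩
      ιℕ (suc n ℕ.+ 1) * D (suc n) 1                 ≡⟨ P.cong (λ k → ιℕ k * D (suc n) 1) (P.cong suc (ℕP.+-comm n 1)) ⟩
      ιℕ (suc (suc n)) * D (suc n) 1                 ≈⟨ *-congˡ (D[n,1] n) ⟩
      ιℕ (suc (suc n)) * (ιℕ (suc n) * D 1 1)
        ≈⟨ solve 3 (λ a b x → a :* (b :* x) := b :* (a :* x)) refl (ιℕ (suc (suc n))) (ιℕ (suc n)) (D 1 1) ⟩
      ιℕ (suc n) * (ιℕ (suc (suc n)) * D 1 1)        ∎)

    D[1,2] : D 1 2 ≈ ιℕ 2 * D 1 1
    D[1,2] = trans (sym (trans (*-congʳ (+-identityʳ 1#)) (*-identityˡ _))) (D-right 0 0)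

    D[1,1]≈0 : D 1 1 ≈ 0#
    D[1,1]≈0 = dehomogenised-monomial≈0 d 1 Φ (D 1 1)
      (λ x≈x′ y≈y′ → +-cong (f-cong x≈x′ (-‿cong y≈y′)) (-‿cong (*-congˡ (f-cong x≈x′ y≈y′))))
      (D-homogeneous (ιℕ 2))
      (IsPoly-cong (suc d) (IsPoly-+ (suc d) (IsPoly-evalKˡ g (- ιℕ 1)) (IsPoly-*ˡ (suc d) (- s) (IsPoly-evalKˡ g (ιℕ 1))))
        (λ t → solve 3 (λ a s b → a :+ (:- s) :* b := a :- s :* b) refl (f t (- ιℕ 1)) s (f t (ιℕ 1))))
      (ℕP.+-monoˡ-≤ 2 1≤w)
      (λ j → trans (D[n,1] j) (*-congʳ (sym (*-identityʳ _))))
      (trans D[1,2] (*-congʳ (sym (*-identityʳ _))))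
      where
      Φ : Carrier → Carrier → Carrier
      Φ x y = f x (- y) - s * f x y

    parity : FParity s
    parity = euclid-induction (λ a b → f (ιℕ a) (- ιℕ b) ≈ s * f (ιℕ a) (ιℕ b))
      (λ a → x∙y⁻¹≈ε⇒x≈y _ _ (trans (D-diagonal a) (trans (*-congˡ D[1,1]≈0) (zeroʳ _))))
      (λ a b Dab≈0 → x∙y⁻¹≈ε⇒x≈y _ _ (*≈0⇒≈0 (char0 a) (trans (D-left a b) (c*[x-y]≈0 _ Dab≈0))))
      (λ a b Dab≈0 → x∙y⁻¹≈ε⇒x≈y _ _ (*≈0⇒≈0 (char0 b) (trans (D-right a b) (c*[x-y]≈0 _ Dab≈0))))

  parity⇒shifted-symmetry : ∀ s → FParity s → FShiftedSymmetric s
  parity⇒shifted-symmetry s f-parity a b = x∙y⁻¹≈ε⇒x≈y _ _ (*≈0⇒≈0 (char0 b)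
    (≈-by-combination₄ (ι (ℤ.- 1ℤ)) S (- A) (- s) U₁ (f-parity a b) (f-parity (a ℕ.+ suc b) b) U₂
      (solve 10 (λ A B S s X Y P₁ P₂ W Z →
          B :* (W :- s :* Z) :- con 0ℤ
        := con (ℤ.- 1ℤ) :* ((S :* X :+ (:- B) :* W) :- A :* Y) :+ S :* (X :- s :* P₁) :+ (:- A) :* (Y :- s :* P₂)
           :+ (:- s) :* ((A :* P₂ :+ B :* Z) :- S :* P₁))
        refl A B S s (f A (- B)) (f S (- B)) (f A B) (f S B) (f S A) (f A S))))
    where
    A = ιℕ (suc a)
    B = ιℕ (suc b)
    S = ιℕ (suc a ℕ.+ suc b)
    U₁ : S * f A (- B) + (- B) * f S A ≈ A * f S (- B)
    U₁ = U-relation (ιℕ[m+n]-ιℕ[n]≈ιℕ[m] (suc a) (suc b))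
    U₂ : A * f S B + B * f A S ≈ S * f A B
    U₂ = U-relation-ℕ (suc a) (suc b)

-- The sign s is the parity of a symbol E, and σ = -s the symmetry of β(E) and of ĝ.
record SignPair {c ℓ} (F : Field c ℓ) : Set (c ⊔ ℓ) where
  open Field F
  open FieldLemmas F using (-‿distribˡ-*; -‿distribʳ-*; -‿involutive)
  field
    s σ   : Carrier
    s*s≈1 : s * s ≈ 1#
    σ≈-s  : σ ≈ - s

  σ*σ≈1 : σ * σ ≈ 1#
  σ*σ≈1 = trans (*-cong σ≈-s σ≈-s) (trans (sym (-‿distribˡ-* s (- s))) (trans (-‿cong (sym (-‿distribʳ-* s s))) (trans (-‿involutive _) s*s≈1)))

  s*σ≈-1 : s * σ ≈ ι (ℤ.- 1ℤ)
  s*σ≈-1 = trans (*-congˡ σ≈-s) (trans (sym (-‿distribʳ-* s s)) (-‿cong (trans s*s≈1 (sym (+-identityʳ 1#)))))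

  σ+s≈0 : σ + s ≈ 0#
  σ+s≈0 = trans (+-congʳ σ≈-s) (-‿inverseˡ s)

odd-signs even-signs : ∀ {c ℓ} (F : Field c ℓ) → SignPair F
odd-signs F = record
  { s = - 1# ; σ = 1# ; s*s≈1 = trans (-1*x≈-x (- 1#)) (-‿involutive 1#) ; σ≈-s = sym (-‿involutive 1#) }
  where
  open Field F
  open FieldLemmas F
even-signs F = record { s = 1# ; σ = - 1# ; s*s≈1 = *-identityˡ 1# ; σ≈-s = refl }
  where
  open Field F

module Hat {c ℓ} (F : Field c ℓ) {w : ℕ} (g : HomPoly F (w ℕ.+ 2)) (g∈U : InU F w g) where
  open Field F
  open FieldLemmas F
  open PolynomialFunctions F
  open HomogeneousForms F
  open FormsInU F g g∈U
  open import Relation.Binary.Reasoning.Setoid setoid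

  c₀ : Carrier
  c₀ = evalℤ F g 1ℤ 1ℤ

  γ γ⁻ : ℕ → ℕ → Carrier
  γ  a b = hat F w g (+ a) (+ b)
  γ⁻ a b = hat F w g (+ a) (ℤ.- + b)

  δ : ℕ → ℕ → Carrier
  δ a b = ιℕ (ℕGCD.gcd a b) ^ d

  HatSymmetric HatParity : Carrier → Set ℓ
  HatSymmetric σ = ∀ a b → γ (suc b) (suc a) ≈ σ * γ (suc a) (suc b)
  HatParity s    = ∀ a b → γ⁻ (suc a) (suc b) ≈ s * γ (suc a) (suc b)

  hat-spec : ∀ h k → ι h ≉ 0# → ι k ≉ 0# → (ι h * ι k) * hat F w g h k ≈ evalℤ F g h k - c₀ * ι (gcd h k) ^ d
  hat-spec h k h≉0 k≉0 = trans (*-congʳ (sym (ι-homo-* h k))) (*-⁻¹-cancelˡ _ hk≉0)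
    where
    hk≉0 : ι (h ℤ.* k) ≉ 0#
    hk≉0 hk≈0 = *-≉0 h≉0 k≉0 (trans (sym (ι-homo-* h k)) hk≈0)

  hat-pos : ∀ a b → (ιℕ (suc a) * ιℕ (suc b)) * γ (suc a) (suc b) ≈ f (ιℕ (suc a)) (ιℕ (suc b)) - c₀ * δ (suc a) (suc b)
  hat-pos a b = hat-spec (+ suc a) (+ suc b) (char0 a) (char0 b)

  hat-neg : ∀ a b → (ιℕ (suc a) * - ιℕ (suc b)) * γ⁻ (suc a) (suc b) ≈ f (ιℕ (suc a)) (- ιℕ (suc b)) - c₀ * δ (suc a) (suc b)
  hat-neg a b = hat-spec (+ suc a) -[1+ b ] (char0 a) (-‿≉0 (char0 b))

  f≈hat : ∀ a b → f (ιℕ (suc a)) (ιℕ (suc b)) ≈ (ιℕ (suc a) * ιℕ (suc b)) * γ (suc a) (suc b) + c₀ * δ (suc a) (suc b)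
  f≈hat a b = trans (solve 2 (λ x y → x := (x :- y) :+ y) refl _ (c₀ * δ (suc a) (suc b))) (+-congʳ (sym (hat-pos a b)))

  f-neg≈hat : ∀ a b → f (ιℕ (suc a)) (- ιℕ (suc b)) ≈ (ιℕ (suc a) * - ιℕ (suc b)) * γ⁻ (suc a) (suc b) + c₀ * δ (suc a) (suc b)
  f-neg≈hat a b = trans (solve 2 (λ x y → x := (x :- y) :+ y) refl _ (c₀ * δ (suc a) (suc b))) (+-congʳ (sym (hat-neg a b)))

  δ-comm : ∀ a b → δ a b ≈ δ b a
  δ-comm a b = reflexive (P.cong (λ n → ιℕ n ^ d) (ℕGCD.gcd-comm a b))

  δ[n,1]≈1 : ∀ n → δ n 1 ≈ 1#
  δ[n,1]≈1 n = trans (reflexive (P.cong (λ k → ιℕ k ^ d) (ℕGCD.gcd-zeroʳ n))) (trans (^-congˡ d (+-identityʳ 1#)) (1#^n≈1# d))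

  f[x,x] : ∀ x → f x x ≈ x ^ d * c₀
  f[x,x] x = trans (f-cong x≈x*1 x≈x*1) (evalK-homogeneous g x (ιℕ 1) (ιℕ 1))
    where
    x≈x*1 : x ≈ x * ιℕ 1
    x≈x*1 = sym (trans (*-congˡ (+-identityʳ 1#)) (*-identityʳ x))

  hat-diagonal : ∀ a → γ (suc a) (suc a) ≈ 0#
  hat-diagonal a = *≈0⇒≈0 (*-≉0 (char0 a) (char0 a)) (begin
    (A * A) * γ (suc a) (suc a)                      ≈⟨ hat-pos a a ⟩
    f A A - c₀ * ιℕ (ℕGCD.gcd (suc a) (suc a)) ^ d   ≡⟨ P.cong (λ n → f A A - c₀ * ιℕ n ^ d) (gcd[n,n]≡n (suc a)) ⟩
    f A A - c₀ * A ^ d                               ≈⟨ +-congʳ (f[x,x] A) ⟩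
    A ^ d * c₀ - c₀ * A ^ d                          ≈⟨ solve 2 (λ x y → x :* y :- y :* x := con 0ℤ) refl (A ^ d) c₀ ⟩
    0#                                               ∎)
    where A = ιℕ (suc a)

  hat-three-term : ∀ a b → γ (suc a ℕ.+ suc b) (suc b) + γ (suc a) (suc a ℕ.+ suc b) ≈ γ (suc a) (suc b)
  hat-three-term a b = *-cancelˡ-≉0 (*-≉0 (*-≉0 (char0 a) (char0 b)) (char0 (a ℕ.+ suc b))) (begin
    (A * B) * S * (γ sS sB + γ sA sS)
      ≈⟨ solve 5 (λ A B S x y → (A :* B) :* S :* (x :+ y) := A :* ((S :* B) :* x) :+ B :* ((A :* S) :* y)) refl A B S (γ sS sB) (γ sA sS) ⟩
    A * ((S * B) * γ sS sB) + B * ((A * S) * γ sA sS)    ≈⟨ +-cong (*-congˡ (hat-pos (a ℕ.+ suc b) b)) (*-congˡ (hat-pos a (a ℕ.+ suc b))) ⟩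
    A * (f S B - c₀ * δ sS sB) + B * (f A S - c₀ * δ sA sS)
      ≡⟨ P.cong₂ (λ m n → A * (f S B - c₀ * ιℕ m ^ d) + B * (f A S - c₀ * ιℕ n ^ d)) (gcd[m+n,n]≡gcd[m,n] sA sB) (gcd[m,m+n]≡gcd[m,n] sA sB) ⟩
    A * (f S B - c₀ * δ sA sB) + B * (f A S - c₀ * δ sA sB)
      ≈⟨ solve 6 (λ A B x y c e → A :* (x :- c :* e) :+ B :* (y :- c :* e) := (A :* x :+ B :* y) :- (A :+ B) :* (c :* e)) refl A B (f S B) (f A S) c₀ (δ sA sB) ⟩
    (A * f S B + B * f A S) - (A + B) * (c₀ * δ sA sB)   ≈⟨ +-cong (U-relation-ℕ sA sB) (-‿cong (*-congʳ (sym (ιℕ-homo-+ sA sB)))) ⟩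
    S * f A B - S * (c₀ * δ sA sB)
      ≈⟨ solve 3 (λ S x y → S :* x :- S :* y := S :* (x :- y)) refl S (f A B) (c₀ * δ sA sB) ⟩
    S * (f A B - c₀ * δ sA sB)                           ≈⟨ *-congˡ (hat-pos a b) ⟨
    S * ((A * B) * γ sA sB)                              ≈⟨ solve 4 (λ S A B x → S :* ((A :* B) :* x) := (A :* B) :* S :* x) refl S A B (γ sA sB) ⟩
    (A * B) * S * γ sA sB                                ∎)
    where
    sA = suc a
    sB = suc b
    sS = suc a ℕ.+ suc b
    A = ιℕ sA
    B = ιℕ sB
    S = ιℕ sS

  hat-homogeneous : ∀ c a b → γ (suc c ℕ.* suc a) (suc c ℕ.* suc b) ≈ ιℕ (suc c) ^ w * γ (suc a) (suc b)
  hat-homogeneous c a b = *-cancelˡ-≉0 (*-≉0 (char0 (a ℕ.+ c ℕ.* suc a)) (char0 (b ℕ.+ c ℕ.* suc b))) (begin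
    (CA * CB) * γ (sC ℕ.* sA) (sC ℕ.* sB)          ≈⟨ hat-pos (a ℕ.+ c ℕ.* suc a) (b ℕ.+ c ℕ.* suc b) ⟩
    f CA CB - c₀ * ιℕ (ℕGCD.gcd (sC ℕ.* sA) (sC ℕ.* sB)) ^ d
      ≡⟨ P.cong (λ n → f CA CB - c₀ * ιℕ n ^ d) (ℕGCD.c*gcd[m,n]≡gcd[cm,cn] sC sA sB) ⟨
    f CA CB - c₀ * ιℕ (sC ℕ.* ℕGCD.gcd sA sB) ^ d  ≈⟨ +-cong (trans (f-cong (ιℕ-homo-* sC sA) (ιℕ-homo-* sC sB)) (evalK-homogeneous g C A B))
                                                             (-‿cong (*-congˡ (trans (^-congˡ d (ιℕ-homo-* sC (ℕGCD.gcd sA sB))) (^-distrib-* C _ d)))) ⟩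
    C ^ d * f A B - c₀ * (C ^ d * δ sA sB)
      ≈⟨ solve 4 (λ t x c e → t :* x :- c :* (t :* e) := t :* (x :- c :* e)) refl (C ^ d) (f A B) c₀ (δ sA sB) ⟩
    C ^ d * (f A B - c₀ * δ sA sB)                 ≈⟨ *-congˡ (hat-pos a b) ⟨
    C ^ d * ((A * B) * γ sA sB)                    ≈⟨ *-congʳ (trans (^-homo-* C w 2) (*-congˡ (*-congˡ (*-identityʳ C)))) ⟩
    (C ^ w * (C * C)) * ((A * B) * γ sA sB)
      ≈⟨ solve 5 (λ Cʷ C A B x → (Cʷ :* (C :* C)) :* ((A :* B) :* x) := ((C :* A) :* (C :* B)) :* (Cʷ :* x)) refl (C ^ w) C A B (γ sA sB) ⟩
    ((C * A) * (C * B)) * (C ^ w * γ sA sB)        ≈⟨ *-congʳ (*-cong (ιℕ-homo-* sC sA) (ιℕ-homo-* sC sB)) ⟨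
    (CA * CB) * (C ^ w * γ sA sB)                  ∎)
    where
    sC = suc c
    sA = suc a
    sB = suc b
    C = ιℕ sC
    A = ιℕ sA
    B = ιℕ sB
    CA = ιℕ (sC ℕ.* sA)
    CB = ιℕ (sC ℕ.* sB)

  module Signed (signs : SignPair F) where
    open SignPair signs

    -- In both lemmas Φ is homogeneous of degree d > 0 and equals (1 - σ) c₀ at (j,1) and at (1,2).
    hatSymmetric⇒σ*c₀≈c₀ : 1 ℕ.≤ w → HatSymmetric σ → σ * c₀ ≈ c₀
    hatSymmetric⇒σ*c₀≈c₀ 1≤w γ-sym = sym (x∙y⁻¹≈ε⇒x≈y _ _ (constant-on-rays⇒≈0 d Φ (c₀ - σ * c₀)
        (λ x≈x′ y≈y′ → +-cong (f-cong y≈y′ x≈x′) (-‿cong (*-congˡ (f-cong x≈x′ y≈y′))))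
        (λ x y → trans (+-cong (evalK-homogeneous g (ιℕ 2) y x) (-‿cong (*-congˡ (evalK-homogeneous g (ιℕ 2) x y))))
                       (solve 4 (λ t u σ v → t :* u :- σ :* (t :* v) := t :* (u :- σ :* v)) refl (ιℕ 2 ^ d) (f y x) σ (f x y)))
        (IsPoly-+ (suc d) (IsPoly-cong (suc d) (IsPoly-evalKʳ g (ιℕ 1) 1#) (λ t → f-cong refl (*-identityˡ t)))
                          (IsPoly-cong (suc d) (IsPoly-*ˡ (suc d) (- σ) (IsPoly-evalKˡ g (ιℕ 1))) (λ t → sym (-‿distribˡ-* σ _))))
        (ℕP.≤-trans (ℕ.s≤s ℕ.z≤n) (ℕP.+-monoˡ-≤ 2 1≤w))
        (λ j → trans (Φ[a,b] j 0) (trans (*-congˡ (δ[n,1]≈1 (suc j))) (*-identityʳ _)))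
        (trans (Φ[a,b] 0 1) (trans (*-congˡ (trans (δ-comm 1 2) (δ[n,1]≈1 2))) (*-identityʳ _)))))
      where
      Φ : Carrier → Carrier → Carrier
      Φ x y = f y x - σ * f x y
      Φ[a,b] : ∀ a b → Φ (ιℕ (suc a)) (ιℕ (suc b)) ≈ (c₀ - σ * c₀) * δ (suc a) (suc b)
      Φ[a,b] a b = begin
        f B A - σ * f A B                                       ≈⟨ +-cong (f≈hat b a) (-‿cong (*-congˡ (f≈hat a b))) ⟩
        ((B * A) * γ (suc b) (suc a) + c₀ * δ (suc b) (suc a)) - σ * ((A * B) * Γ + c₀ * Δ)
          ≈⟨ +-congʳ (+-cong (*-cong (*-comm B A) (γ-sym a b)) (*-congˡ (δ-comm (suc b) (suc a)))) ⟩
        ((A * B) * (σ * Γ) + c₀ * Δ) - σ * ((A * B) * Γ + c₀ * Δ)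
          ≈⟨ solve 5 (λ X σ Γ c Δ → (X :* (σ :* Γ) :+ c :* Δ) :- σ :* (X :* Γ :+ c :* Δ) := (c :- σ :* c) :* Δ) refl (A * B) σ Γ c₀ Δ ⟩
        (c₀ - σ * c₀) * Δ                                       ∎
        where
        A = ιℕ (suc a)
        B = ιℕ (suc b)
        Γ = γ (suc a) (suc b)
        Δ = δ (suc a) (suc b)

    hatParity⇒σ*c₀≈c₀ : 1 ℕ.≤ w → HatParity s → σ * c₀ ≈ c₀
    hatParity⇒σ*c₀≈c₀ 1≤w γ-par = sym (x∙y⁻¹≈ε⇒x≈y _ _ (constant-on-rays⇒≈0 d Φ (c₀ - σ * c₀)
        (λ x≈x′ y≈y′ → +-cong (f-cong y≈y′ (-‿cong x≈x′)) (-‿cong (*-congˡ (f-cong y≈y′ x≈x′))))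
        (λ x y → trans (+-cong (trans (f-cong refl (-‿distribʳ-* (ιℕ 2) x)) (evalK-homogeneous g (ιℕ 2) y (- x)))
                               (-‿cong (*-congˡ (evalK-homogeneous g (ιℕ 2) y x))))
                       (solve 4 (λ t u σ v → t :* u :- σ :* (t :* v) := t :* (u :- σ :* v)) refl (ιℕ 2 ^ d) (f y (- x)) σ (f y x)))
        (IsPoly-+ (suc d) (IsPoly-cong (suc d) (IsPoly-evalKʳ g (ιℕ 1) (- 1#)) (λ t → f-cong refl (-1*x≈-x t)))
                          (IsPoly-cong (suc d) (IsPoly-*ˡ (suc d) (- σ) (IsPoly-evalKʳ g (ιℕ 1) 1#))
                                       (λ t → trans (sym (-‿distribˡ-* σ _)) (-‿cong (*-congˡ (f-cong refl (*-identityˡ t)))))))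
        (ℕP.≤-trans (ℕ.s≤s ℕ.z≤n) (ℕP.+-monoˡ-≤ 2 1≤w))
        (λ j → trans (Φ[b,a] 0 j) (trans (*-congˡ (trans (δ-comm 1 (suc j)) (δ[n,1]≈1 (suc j)))) (*-identityʳ _)))
        (trans (Φ[b,a] 1 0) (trans (*-congˡ (δ[n,1]≈1 2)) (*-identityʳ _)))))
      where
      Φ : Carrier → Carrier → Carrier
      Φ x y = f y (- x) - σ * f y x
      Φ[b,a] : ∀ a b → Φ (ιℕ (suc b)) (ιℕ (suc a)) ≈ (c₀ - σ * c₀) * δ (suc a) (suc b)
      Φ[b,a] a b = begin
        f A (- B) - σ * f A B                                   ≈⟨ +-cong (f-neg≈hat a b) (-‿cong (*-congˡ (f≈hat a b))) ⟩
        ((A * - B) * γ⁻ (suc a) (suc b) + c₀ * Δ) - σ * ((A * B) * Γ + c₀ * Δ)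
          ≈⟨ +-congʳ (+-congʳ (*-congˡ (trans (γ-par a b) (*-congʳ (trans (sym (-‿involutive s)) (-‿cong (sym σ≈-s))))))) ⟩
        ((A * - B) * (- σ * Γ) + c₀ * Δ) - σ * ((A * B) * Γ + c₀ * Δ)
          ≈⟨ solve 6 (λ A B σ Γ c Δ → (A :* (:- B) :* ((:- σ) :* Γ) :+ c :* Δ) :- σ :* (A :* B :* Γ :+ c :* Δ) := (c :- σ :* c) :* Δ) refl A B σ Γ c₀ Δ ⟩
        (c₀ - σ * c₀) * Δ                                       ∎
        where
        A = ιℕ (suc a)
        B = ιℕ (suc b)
        Γ = γ (suc a) (suc b)
        Δ = δ (suc a) (suc b)

    module _ (σ*c₀≈c₀ : σ * c₀ ≈ c₀) where

      hatSymmetric⇒fSymmetric : HatSymmetric σ → FSymmetric σ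
      hatSymmetric⇒fSymmetric γ-sym a b = begin
        f B A                                               ≈⟨ f≈hat b a ⟩
        (B * A) * γ (suc b) (suc a) + c₀ * δ (suc b) (suc a)
          ≈⟨ +-cong (*-cong (*-comm B A) (γ-sym a b)) (*-cong (sym σ*c₀≈c₀) (δ-comm (suc b) (suc a))) ⟩
        (A * B) * (σ * Γ) + (σ * c₀) * Δ
          ≈⟨ solve 6 (λ A B σ Γ c Δ → (A :* B) :* (σ :* Γ) :+ (σ :* c) :* Δ := σ :* ((A :* B) :* Γ :+ c :* Δ)) refl A B σ Γ c₀ Δ ⟩
        σ * ((A * B) * Γ + c₀ * Δ)                          ≈⟨ *-congˡ (f≈hat a b) ⟨
        σ * f A B                                           ∎
        where
        A = ιℕ (suc a)
        B = ιℕ (suc b)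
        Γ = γ (suc a) (suc b)
        Δ = δ (suc a) (suc b)

      fParity⇒hatParity : FParity σ → HatParity s
      fParity⇒hatParity f-par a b = *-cancelˡ-≉0 (*-≉0 (char0 a) (-‿≉0 (char0 b))) (begin
        (A * - B) * γ⁻ (suc a) (suc b)   ≈⟨ hat-neg a b ⟩
        f A (- B) - c₀ * Δ               ≈⟨ +-cong (f-par a b) (-‿cong (*-congʳ (sym σ*c₀≈c₀))) ⟩
        σ * f A B - (σ * c₀) * Δ         ≈⟨ solve 4 (λ σ x c Δ → σ :* x :- (σ :* c) :* Δ := σ :* (x :- c :* Δ)) refl σ (f A B) c₀ Δ ⟩
        σ * (f A B - c₀ * Δ)             ≈⟨ *-cong (sym σ≈-s) (hat-pos a b) ⟨
        - s * ((A * B) * Γ)              ≈⟨ solve 4 (λ s A B Γ → (:- s) :* ((A :* B) :* Γ) := (A :* (:- B)) :* (s :* Γ)) refl s A B Γ ⟩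
        (A * - B) * (s * Γ)              ∎)
        where
        A = ιℕ (suc a)
        B = ιℕ (suc b)
        Γ = γ (suc a) (suc b)
        Δ = δ (suc a) (suc b)

      hatParity⇒fParity : HatParity s → FParity σ
      hatParity⇒fParity γ-par a b = begin
        f A (- B)                            ≈⟨ f-neg≈hat a b ⟩
        (A * - B) * γ⁻ (suc a) (suc b) + c₀ * Δ ≈⟨ +-cong (*-congˡ (γ-par a b)) (*-congʳ (sym σ*c₀≈c₀)) ⟩
        (A * - B) * (s * Γ) + (σ * c₀) * Δ   ≈⟨ +-congʳ (solve 4 (λ s A B Γ → (A :* (:- B)) :* (s :* Γ) := (:- s) :* ((A :* B) :* Γ)) refl s A B Γ) ⟩
        - s * ((A * B) * Γ) + (σ * c₀) * Δ   ≈⟨ +-congʳ (*-congʳ σ≈-s) ⟨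
        σ * ((A * B) * Γ) + (σ * c₀) * Δ     ≈⟨ solve 4 (λ σ X c Δ → σ :* X :+ (σ :* c) :* Δ := σ :* (X :+ c :* Δ)) refl σ ((A * B) * Γ) c₀ Δ ⟩
        σ * ((A * B) * Γ + c₀ * Δ)           ≈⟨ *-congˡ (f≈hat a b) ⟨
        σ * f A B                            ∎
        where
        A = ιℕ (suc a)
        B = ιℕ (suc b)
        Γ = γ (suc a) (suc b)
        Δ = δ (suc a) (suc b)

      hat-shifted-symmetry : FShiftedSymmetric σ → ∀ a b → γ (suc a ℕ.+ suc b) (suc a) ≈ σ * γ (suc a) (suc a ℕ.+ suc b)
      hat-shifted-symmetry f-sym a b = *-cancelˡ-≉0 (*-≉0 (char0 (a ℕ.+ suc b)) (char0 a)) (begin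
        (S * A) * γ (suc a ℕ.+ suc b) (suc a)        ≈⟨ hat-pos (a ℕ.+ suc b) a ⟩
        f S A - c₀ * δ (suc a ℕ.+ suc b) (suc a)     ≈⟨ +-cong (f-sym a b) (-‿cong (*-cong (sym σ*c₀≈c₀) (δ-comm (suc a ℕ.+ suc b) (suc a)))) ⟩
        σ * f A S - (σ * c₀) * Δ                     ≈⟨ solve 4 (λ σ x c Δ → σ :* x :- (σ :* c) :* Δ := σ :* (x :- c :* Δ)) refl σ (f A S) c₀ Δ ⟩
        σ * (f A S - c₀ * Δ)                         ≈⟨ *-congˡ (hat-pos a (a ℕ.+ suc b)) ⟨
        σ * ((A * S) * Γ)                            ≈⟨ solve 4 (λ σ A S Γ → σ :* ((A :* S) :* Γ) := (S :* A) :* (σ :* Γ)) refl σ A S Γ ⟩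
        (S * A) * (σ * Γ)                            ∎)
        where
        A = ιℕ (suc a)
        S = ιℕ (suc a ℕ.+ suc b)
        Γ = γ (suc a) (suc a ℕ.+ suc b)
        Δ = δ (suc a) (suc a ℕ.+ suc b)

      shiftedSymmetry⇒hatSymmetric : FShiftedSymmetric σ → HatSymmetric σ
      shiftedSymmetry⇒hatSymmetric f-sym a b with ℕ.compare a b
      ... | ℕ.equal a     = trans (hat-diagonal a) (sym (trans (*-congˡ (hat-diagonal a)) (zeroʳ σ)))
      ... | ℕ.less a k    = P.subst (λ n → γ n (suc a) ≈ σ * γ (suc a) n) (P.cong suc (ℕP.+-suc a k)) (hat-shifted-symmetry f-sym a k)
      ... | ℕ.greater b k = begin
        γ (suc b) B                 ≈⟨ *-identityˡ _ ⟨
        1# * γ (suc b) B            ≈⟨ *-congʳ σ*σ≈1 ⟨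
        (σ * σ) * γ (suc b) B       ≈⟨ *-assoc σ σ _ ⟩
        σ * (σ * γ (suc b) B)
          ≈⟨ *-congˡ (P.subst (λ n → γ n (suc b) ≈ σ * γ (suc b) n) (P.cong suc (ℕP.+-suc b k)) (hat-shifted-symmetry f-sym b k)) ⟨
        σ * γ B (suc b)             ∎
        where B = suc (suc (b ℕ.+ k))

    hatSymmetric⇒hatParity : (- 1#) ^ d ≈ 1# → 1 ℕ.≤ w → HatSymmetric σ → HatParity s
    hatSymmetric⇒hatParity [-1]^d≈1 1≤w γ-sym = fParity⇒hatParity σ*c₀≈c₀
      (Symmetric⇒Parity.parity σ σ*σ≈1 [-1]^d≈1 1≤w (hatSymmetric⇒fSymmetric σ*c₀≈c₀ γ-sym))
      where σ*c₀≈c₀ = hatSymmetric⇒σ*c₀≈c₀ 1≤w γ-sym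

    hatParity⇒hatSymmetric : 1 ℕ.≤ w → HatParity s → HatSymmetric σ
    hatParity⇒hatSymmetric 1≤w γ-par = shiftedSymmetry⇒hatSymmetric σ*c₀≈c₀
      (parity⇒shifted-symmetry σ (hatParity⇒fParity σ*c₀≈c₀ γ-par))
      where σ*c₀≈c₀ = hatParity⇒σ*c₀≈c₀ 1≤w γ-par

-- The symbol E with parity s and β(E) = γ, built by the Euclidean recursion
-- E(h, r) = γ(h, r) + s E(r, h mod r) for 0 < r < h; the fuel n ≥ h bounds the recursion depth.
module Construction {c ℓ} (F : Field c ℓ) where
  open Field F
  open FieldLemmas F
  open import Relation.Binary.Reasoning.Setoid setoid

  module Recursion (w : ℕ) (signs : SignPair F) (γ : ℕ → ℕ → Carrier)
    (γ-symmetric   : ∀ a b → γ (suc b) (suc a) ≈ SignPair.σ signs * γ (suc a) (suc b))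
    (γ-diagonal    : ∀ a → γ (suc a) (suc a) ≈ 0#)
    (γ-three-term  : ∀ a b → γ (suc a ℕ.+ suc b) (suc b) + γ (suc a) (suc a ℕ.+ suc b) ≈ γ (suc a) (suc b))
    (γ-homogeneous : ∀ c a b → γ (suc c ℕ.* suc a) (suc c ℕ.* suc b) ≈ ιℕ (suc c) ^ w * γ (suc a) (suc b))
    where
    open SignPair signs

    step : (ℕ → ℕ → Carrier) → ℕ → ℕ → Carrier
    step E h zero    = 0#
    step E h (suc r) = γ h (suc r) + s * E (suc r) h

    E-fuel : ℕ → ℕ → ℕ → Carrier
    E-fuel zero    h       r = 0#
    E-fuel (suc n) zero    r = 0#
    E-fuel (suc n) (suc h) r = step (E-fuel n) (suc h) (r ℕ.% suc h)

    Eℕ : ℕ → ℕ → Carrier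
    Eℕ h = E-fuel h h

    E-fuel-irrelevant : ∀ m n h r → h ℕ.≤ m → h ℕ.≤ n → E-fuel m h r ≈ E-fuel n h r
    E-fuel-irrelevant zero    zero    zero    r _ _ = refl
    E-fuel-irrelevant zero    (suc n) zero    r _ _ = refl
    E-fuel-irrelevant (suc m) zero    zero    r _ _ = refl
    E-fuel-irrelevant (suc m) (suc n) zero    r _ _ = refl
    E-fuel-irrelevant (suc m) (suc n) (suc h) r (ℕ.s≤s h≤m) (ℕ.s≤s h≤n) = same-step (r ℕ.% suc h) (ℕDivMod.m%n<n r (suc h))
      where
      same-step : ∀ ρ → ρ ℕ.< suc h → step (E-fuel m) (suc h) ρ ≈ step (E-fuel n) (suc h) ρ
      same-step zero    _            = refl
      same-step (suc ρ) (ℕ.s≤s ρ<h) =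
        +-congˡ (*-congˡ (E-fuel-irrelevant m n (suc ρ) (suc h) (ℕP.≤-trans ρ<h h≤m) (ℕP.≤-trans ρ<h h≤n)))

    Eℕ-unfold : ∀ h r → suc r ℕ.< suc h → Eℕ (suc h) (suc r) ≈ γ (suc h) (suc r) + s * Eℕ (suc r) (suc h)
    Eℕ-unfold h r r<h = trans (reflexive (P.cong (step (E-fuel h) (suc h)) (ℕDivMod.m<n⇒m%n≡m r<h)))
                              (+-congˡ (*-congˡ (E-fuel-irrelevant h (suc r) (suc r) (suc h) (ℕP.≤-pred r<h) ℕP.≤-refl)))

    Eℕ-divisible : ∀ h r → r ℕ.% suc h ≡ 0 → Eℕ (suc h) r ≈ 0#
    Eℕ-divisible h r r%h≡0 = reflexive (P.cong (step (E-fuel h) (suc h)) r%h≡0)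

    Eℕ-mod : ∀ h r → Eℕ (suc h) r ≡ Eℕ (suc h) (r ℕ.% suc h)
    Eℕ-mod h r = P.cong (step (E-fuel h) (suc h)) (P.sym (ℕDivMod.m%n%n≡m%n r (suc h)))

    Eℕ-periodic : ∀ h r → Eℕ (suc h) (suc h ℕ.+ r) ≡ Eℕ (suc h) r
    Eℕ-periodic h r = P.cong (step (E-fuel h) (suc h)) (P.trans (P.cong (ℕ._% suc h) (ℕP.+-comm (suc h) r)) (ℕDivMod.[m+n]%n≡m%n r (suc h)))

    Eℕ-β : ∀ a b → Eℕ (suc a) (suc b) - s * Eℕ (suc b) (suc a) ≈ γ (suc a) (suc b)
    Eℕ-β a b with ℕ.compare a b
    ... | ℕ.equal a = begin
      Eℕ (suc a) (suc a) - s * Eℕ (suc a) (suc a)  ≈⟨ +-cong Eaa≈0 (-‿cong (*-congˡ Eaa≈0)) ⟩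
      0# - s * 0#                                  ≈⟨ solve 1 (λ s → con 0ℤ :- s :* con 0ℤ := con 0ℤ) refl s ⟩
      0#                                           ≈⟨ γ-diagonal a ⟨
      γ (suc a) (suc a)                            ∎
      where
      Eaa≈0 : Eℕ (suc a) (suc a) ≈ 0#
      Eaa≈0 = Eℕ-divisible a (suc a) (ℕDivMod.n%n≡0 (suc a))
    ... | ℕ.greater b k = begin
      Eℕ A (suc b) - s * Eℕ (suc b) A                       ≈⟨ +-congʳ (Eℕ-unfold (suc (b ℕ.+ k)) b (ℕ.s≤s (ℕ.s≤s (ℕP.m≤m+n b k)))) ⟩
      (γ A (suc b) + s * Eℕ (suc b) A) - s * Eℕ (suc b) A   ≈⟨ solve 2 (λ x y → (x :+ y) :- y := x) refl (γ A (suc b)) (s * Eℕ (suc b) A) ⟩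
      γ A (suc b)                                           ∎
      where A = suc (suc (b ℕ.+ k))
    ... | ℕ.less a k = ≈-by-combination₄ (- s) (- X) (- s) (- Γ) (Eℕ-unfold (suc (a ℕ.+ k)) a (ℕ.s≤s (ℕ.s≤s (ℕP.m≤m+n a k))))
        (trans s*s≈1 (sym (+-identityʳ 1#))) (γ-symmetric a (suc (a ℕ.+ k))) s*σ≈-1
        (solve 6 (λ X Y Γ Γ′ s σ → (X :- s :* Y) :- Γ
           := (:- s) :* (Y :- (Γ′ :+ s :* X)) :+ (:- X) :* (s :* s :- con 1ℤ) :+ (:- s) :* (Γ′ :- σ :* Γ) :+ (:- Γ) :* (s :* σ :- con (ℤ.- 1ℤ)))
          refl X (Eℕ B (suc a)) Γ (γ B (suc a)) s σ)
      where
      B = suc (suc (a ℕ.+ k))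
      X = Eℕ (suc a) B
      Γ = γ (suc a) B

    Eℕ-reflect : ∀ t r → Eℕ (suc t ℕ.+ suc r) (suc t) ≈ s * Eℕ (suc t ℕ.+ suc r) (suc r)
    Eℕ-reflect t r = x∙y⁻¹≈ε⇒x≈y _ _ (begin
      Eℕ H (suc t) - s * Eℕ H (suc r)
        ≈⟨ +-cong (trans (Eℕ-unfold (t ℕ.+ suc r) t t<h) (+-congˡ (*-congˡ (reflexive (Eℕ-periodic t (suc r))))))
                  (-‿cong (*-congˡ (trans (Eℕ-unfold (t ℕ.+ suc r) r r<h) (+-congˡ (*-congˡ (reflexive Eℕ[r,h]≡Eℕ[r,t])))))) ⟩
      (γ H (suc t) + s * X) - s * (γ H (suc r) + s * Y)
        ≈⟨ solve 5 (λ Γ₁ Γ₂ s X Y → (Γ₁ :+ s :* X) :- s :* (Γ₂ :+ s :* Y) := Γ₁ :- s :* Γ₂ :+ s :* (X :- s :* Y)) refl (γ H (suc t)) (γ H (suc r)) s X Y ⟩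
      γ H (suc t) - s * γ H (suc r) + s * (X - s * Y)
        ≈⟨ +-cong (+-congʳ (γ-symmetric t (t ℕ.+ suc r))) (*-congˡ (trans (Eℕ-β t r) (sym (γ-three-term t r)))) ⟩
      σ * Γ - s * γ H (suc r) + s * (γ H (suc r) + Γ)
        ≈⟨ solve 4 (λ σ s Γ₂ Γ → σ :* Γ :- s :* Γ₂ :+ s :* (Γ₂ :+ Γ) := (σ :+ s) :* Γ) refl σ s (γ H (suc r)) Γ ⟩
      (σ + s) * Γ                                    ≈⟨ *-congʳ σ+s≈0 ⟩
      0# * Γ                                         ≈⟨ zeroˡ Γ ⟩
      0#                                             ∎)
      where
      H = suc t ℕ.+ suc r
      X = Eℕ (suc t) (suc r)
      Y = Eℕ (suc r) (suc t)
      Γ = γ (suc t) H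
      t<h : suc t ℕ.< H
      t<h = ℕ.s≤s (ℕP.m<m+n t ℕ.z<s)
      r<h : suc r ℕ.< H
      r<h = ℕ.s≤s (ℕP.m≤n+m (suc r) t)
      Eℕ[r,h]≡Eℕ[r,t] : Eℕ (suc r) H ≡ Eℕ (suc r) (suc t)
      Eℕ[r,h]≡Eℕ[r,t] = P.trans (P.cong (Eℕ (suc r)) (ℕP.+-comm (suc t) (suc r))) (Eℕ-periodic r (suc t))

    Eℕ-complement : ∀ h r → suc r ℕ.< suc h → Eℕ (suc h) (suc h ℕ.∸ suc r) ≈ s * Eℕ (suc h) (suc r)
    Eℕ-complement h r r<h with ℕP.m≤n⇒∃[o]m+o≡n (ℕP.≤-pred r<h)
    ... | o , P.refl = begin
      Eℕ H (H ℕ.∸ suc r)                 ≡⟨ P.cong (Eℕ H) (P.trans (P.cong (ℕ._∸ r) (P.sym (ℕP.+-suc r o))) (ℕP.m+n∸m≡n r (suc o))) ⟩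
      Eℕ H (suc o)                       ≡⟨ P.cong (λ n → Eℕ n (suc o)) o+r≡h ⟨
      Eℕ (suc o ℕ.+ suc r) (suc o)       ≈⟨ Eℕ-reflect o r ⟩
      s * Eℕ (suc o ℕ.+ suc r) (suc r)   ≡⟨ P.cong (λ n → s * Eℕ n (suc r)) o+r≡h ⟩
      s * Eℕ H (suc r)                   ∎
      where
      H = suc (suc r ℕ.+ o)
      o+r≡h : suc o ℕ.+ suc r ≡ H
      o+r≡h = P.cong suc (P.trans (ℕP.+-suc o r) (P.cong suc (ℕP.+-comm o r)))

    Eℕ-homogeneous : ∀ c h r → Eℕ (suc c ℕ.* suc h) (suc c ℕ.* r) ≈ ιℕ (suc c) ^ w * Eℕ (suc h) r
    Eℕ-homogeneous c = <-rec (λ h → ∀ r → Eℕ (suc c ℕ.* suc h) (suc c ℕ.* r) ≈ ιℕ (suc c) ^ w * Eℕ (suc h) r)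
      λ h rec r → by-remainder h rec r (r ℕ.% suc h) P.refl
      where
      C = suc c
      Cʷ = ιℕ C ^ w
      by-remainder : ∀ h → (∀ {ρ} → ρ ℕ.< h → ∀ r → Eℕ (C ℕ.* suc ρ) (C ℕ.* r) ≈ Cʷ * Eℕ (suc ρ) r) →
        ∀ r ρ → r ℕ.% suc h ≡ ρ → Eℕ (C ℕ.* suc h) (C ℕ.* r) ≈ Cʷ * Eℕ (suc h) r
      by-remainder h rec r zero r%h≡0 = begin
        Eℕ (C ℕ.* suc h) (C ℕ.* r)
          ≈⟨ Eℕ-divisible (h ℕ.+ c ℕ.* suc h) (C ℕ.* r) (P.trans ([m*n]%[m*o]≡m*[n%o] c r h) (P.trans (P.cong (C ℕ.*_) r%h≡0) (ℕP.*-zeroʳ C))) ⟩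
        0#                           ≈⟨ zeroʳ Cʷ ⟨
        Cʷ * 0#                      ≈⟨ *-congˡ (Eℕ-divisible h r r%h≡0) ⟨
        Cʷ * Eℕ (suc h) r            ∎
      by-remainder h rec r (suc ρ) r%h≡1+ρ = begin
        Eℕ (C ℕ.* suc h) (C ℕ.* r)
          ≡⟨ P.trans (Eℕ-mod (h ℕ.+ c ℕ.* suc h) (C ℕ.* r)) (P.cong (Eℕ (C ℕ.* suc h)) (P.trans ([m*n]%[m*o]≡m*[n%o] c r h) (P.cong (C ℕ.*_) r%h≡1+ρ))) ⟩
        Eℕ (C ℕ.* suc h) (C ℕ.* suc ρ)                           ≈⟨ Eℕ-unfold (h ℕ.+ c ℕ.* suc h) (ρ ℕ.+ c ℕ.* suc ρ) (ℕP.*-monoʳ-< C ρ<h) ⟩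
        γ (C ℕ.* suc h) (C ℕ.* suc ρ) + s * Eℕ (C ℕ.* suc ρ) (C ℕ.* suc h)
          ≈⟨ +-cong (γ-homogeneous c h ρ) (*-congˡ (rec (ℕP.≤-pred ρ<h) (suc h))) ⟩
        Cʷ * γ (suc h) (suc ρ) + s * (Cʷ * Eℕ (suc ρ) (suc h))
          ≈⟨ solve 4 (λ t x s y → t :* x :+ s :* (t :* y) := t :* (x :+ s :* y)) refl Cʷ (γ (suc h) (suc ρ)) s (Eℕ (suc ρ) (suc h)) ⟩
        Cʷ * (γ (suc h) (suc ρ) + s * Eℕ (suc ρ) (suc h))        ≈⟨ *-congˡ (Eℕ-unfold h ρ ρ<h) ⟨
        Cʷ * Eℕ (suc h) (suc ρ)
          ≡⟨ P.cong (λ x → Cʷ * x) (P.trans (P.cong (Eℕ (suc h)) (P.sym r%h≡1+ρ)) (P.sym (Eℕ-mod h r))) ⟩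
        Cʷ * Eℕ (suc h) r                                        ∎
        where
        ρ<h : suc ρ ℕ.< suc h
        ρ<h = P.subst (ℕ._< suc h) r%h≡1+ρ (ℕDivMod.m%n<n r (suc h))

    E : ℤ → ℤ → Carrier
    E (+ suc h) k = Eℕ (suc h) (k ℤ.%ℕ suc h)
    E _         _ = 0#

    E-isWDS : IsWDS F w E
    E-isWDS = periodic , homogeneous
      where
      periodic : ∀ h k → 0ℤ ℤ.< h → E h k ≈ E h (k ℤ.+ h)
      periodic (+ suc h) k _ = reflexive (P.cong (Eℕ (suc h)) (P.sym (%ℕ-periodic k h)))
      periodic (+ zero)  k (ℤ.+<+ ())
      homogeneous : ∀ (c : ℕ) h k → 0ℤ ℤ.< h → E (+ suc c ℤ.* h) (+ suc c ℤ.* k) ≈ ι (+ suc c) ^ w * E h k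
      homogeneous c (+ suc h) k _ = trans (reflexive (P.cong (Eℕ (suc c ℕ.* suc h)) (%ℕ-homogeneous k c h))) (Eℕ-homogeneous c h (k ℤ.%ℕ suc h))
      homogeneous c (+ zero)  k (ℤ.+<+ ())

    E-parity : ∀ h k → 0ℤ ℤ.< h → E h (ℤ.- k) ≈ s * E h k
    E-parity (+ zero)  k (ℤ.+<+ ())
    E-parity (+ suc h) k _ = by-remainder (k ℤ.%ℕ suc h) P.refl
      where
      H = suc h
      by-remainder : ∀ ρ → k ℤ.%ℕ H ≡ ρ → Eℕ H ((ℤ.- k) ℤ.%ℕ H) ≈ s * Eℕ H (k ℤ.%ℕ H)
      by-remainder zero k%h≡0 = begin
        Eℕ H ((ℤ.- k) ℤ.%ℕ H)  ≈⟨ Eℕ-divisible h ((ℤ.- k) ℤ.%ℕ H) (P.cong (ℕ._% H) (%ℕ-neg-0 k h k%h≡0)) ⟩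
        0#                     ≈⟨ zeroʳ s ⟨
        s * 0#                 ≈⟨ *-congˡ (Eℕ-divisible h (k ℤ.%ℕ H) (P.cong (ℕ._% H) k%h≡0)) ⟨
        s * Eℕ H (k ℤ.%ℕ H)    ∎
      by-remainder (suc ρ) k%h≡1+ρ = begin
        Eℕ H ((ℤ.- k) ℤ.%ℕ H)  ≡⟨ P.cong (Eℕ H) (%ℕ-neg-suc k h ρ k%h≡1+ρ) ⟩
        Eℕ H (H ℕ.∸ suc ρ)     ≈⟨ Eℕ-complement h ρ (P.subst (ℕ._< H) k%h≡1+ρ (ℤDivMod.n%ℕd<d k H)) ⟩
        s * Eℕ H (suc ρ)       ≡⟨ P.cong (λ r → s * Eℕ H r) k%h≡1+ρ ⟨
        s * Eℕ H (k ℤ.%ℕ H)    ∎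

    β-E : ∀ a b → β F E (+ suc a) (+ suc b) ≈ γ (suc a) (suc b)
    β-E a b = begin
      E (+ suc a) (+ suc b) - E (+ suc b) (ℤ.- + suc a)   ≈⟨ +-congˡ (-‿cong (E-parity (+ suc b) (+ suc a) (ℤ.+<+ ℕ.z<s))) ⟩
      Eℕ (suc a) (suc b ℕ.% suc a) - s * Eℕ (suc b) (suc a ℕ.% suc b)
        ≡⟨ P.cong₂ (λ x y → x - s * y) (Eℕ-mod a (suc b)) (Eℕ-mod b (suc a)) ⟨
      Eℕ (suc a) (suc b) - s * Eℕ (suc b) (suc a)         ≈⟨ Eℕ-β a b ⟩
      γ (suc a) (suc b)                                   ∎

BetaVanishes : ∀ {c ℓ} (F : Field c ℓ) → Sym F → Set ℓ
BetaVanishes F E = ∀ h k → 0ℤ ℤ.< h → 0ℤ ℤ.< k → Field._≈_ F (β F E h k) (Field.0# F)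

module Kernel {c ℓ} (F : Field c ℓ) (w : ℕ) (E : Sym F) (E-isWDS : IsWDS F w E) where
  open Field F
  open FieldLemmas F
  open import Relation.Binary.Reasoning.Setoid setoid

  E-periodic : ∀ h k → 0ℤ ℤ.< h → E h k ≈ E h (k ℤ.+ h)
  E-periodic = proj₁ E-isWDS

  E-shift-pos : ∀ h k n → 0ℤ ℤ.< h → E h (k ℤ.+ + n ℤ.* h) ≈ E h k
  E-shift-pos h k zero    0<h = reflexive (P.cong (E h) (P.trans (P.cong (λ x → k ℤ.+ x) (ℤP.*-zeroˡ h)) (ℤP.+-identityʳ k)))
  E-shift-pos h k (suc n) 0<h = begin
    E h (k ℤ.+ + suc n ℤ.* h)          ≡⟨ P.cong (E h) (regroup k (+ n) h) ⟩
    E h ((k ℤ.+ + n ℤ.* h) ℤ.+ h)      ≈⟨ E-periodic h _ 0<h ⟨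
    E h (k ℤ.+ + n ℤ.* h)              ≈⟨ E-shift-pos h k n 0<h ⟩
    E h k                              ∎
    where
    regroup : ∀ k n h → k ℤ.+ (1ℤ ℤ.+ n) ℤ.* h ≡ (k ℤ.+ n ℤ.* h) ℤ.+ h
    regroup = solve-∀

  E-shift : ∀ h k q → 0ℤ ℤ.< h → E h (k ℤ.+ q ℤ.* h) ≈ E h k
  E-shift h k (+ n)    0<h = E-shift-pos h k n 0<h
  E-shift h k -[1+ n ] 0<h = begin
    E h (k ℤ.+ -[1+ n ] ℤ.* h)                              ≈⟨ E-shift-pos h _ (suc n) 0<h ⟨
    E h ((k ℤ.+ -[1+ n ] ℤ.* h) ℤ.+ + suc n ℤ.* h)          ≡⟨ P.cong (E h) (cancel k (+ suc n) h) ⟩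
    E h k                                                   ∎
    where
    cancel : ∀ k m h → (k ℤ.+ (ℤ.- m) ℤ.* h) ℤ.+ m ℤ.* h ≡ k
    cancel = solve-∀

  -- Reducing k modulo h and then swapping E(h,r) = E(r,−h) = s E(r,h) is the Euclidean algorithm.
  E≐0 : ∀ s → (∀ h k → 0ℤ ℤ.< h → E h (ℤ.- k) ≈ s * E h k) → BetaVanishes F E → E (+ 1) (+ 0) ≈ 0# → _≐_ F E (0S F)
  E≐0 s E-parity βE≈0 E[1,0]≈0 (+ zero)  k (ℤ.+<+ ())
  E≐0 s E-parity βE≈0 E[1,0]≈0 (+ suc h) k _ = <-rec (λ h → ∀ k → E (+ suc h) k ≈ 0#) vanish h k
    where
    vanish : ∀ h → (∀ {r} → r ℕ.< h → ∀ k → E (+ suc r) k ≈ 0#) → ∀ k → E (+ suc h) k ≈ 0#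
    vanish h rec k = trans (reflexive (P.cong (E H) (ℤDivMod.a≡a%ℕn+[a/ℕn]*n k (suc h))))
                           (trans (E-shift H _ (k ℤ./ℕ suc h) (ℤ.+<+ ℕ.z<s)) (at-remainder (k ℤ.%ℕ suc h) (ℤDivMod.n%ℕd<d k (suc h))))
      where
      H = + suc h
      at-remainder : ∀ ρ → ρ ℕ.< suc h → E H (+ ρ) ≈ 0#
      at-remainder zero    _   = begin
        E H (+ 0)                 ≡⟨ P.cong₂ E (ℤP.*-identityʳ H) (ℤP.*-zeroʳ H) ⟨
        E (H ℤ.* 1ℤ) (H ℤ.* 0ℤ)   ≈⟨ proj₂ E-isWDS h 1ℤ 0ℤ (ℤ.+<+ ℕ.z<s) ⟩
        ι H ^ w * E 1ℤ 0ℤ         ≈⟨ *-congˡ E[1,0]≈0 ⟩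
        ι H ^ w * 0#              ≈⟨ zeroʳ _ ⟩
        0#                        ∎
      at-remainder (suc r) r<h = begin
        E H (+ suc r)             ≈⟨ x∙y⁻¹≈ε⇒x≈y _ _ (βE≈0 H (+ suc r) (ℤ.+<+ ℕ.z<s) (ℤ.+<+ ℕ.z<s)) ⟩
        E (+ suc r) (ℤ.- H)       ≈⟨ E-parity (+ suc r) H (ℤ.+<+ ℕ.z<s) ⟩
        s * E (+ suc r) H         ≈⟨ *-congˡ (rec (ℕP.≤-pred r<h) H) ⟩
        s * 0#                    ≈⟨ zeroʳ s ⟩
        0#                        ∎

module SymbolG {c ℓ} (F : Field c ℓ) (w : ℕ) where
  open Field F
  open FieldLemmas F
  open HomogeneousForms F
  open import Relation.Binary.Reasoning.Setoid setoid

  G-isWDS : IsWDS F w (G F w)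
  G-isWDS = (λ h k _ → reflexive (P.cong (λ n → ι n ^ w) (P.sym (gcd[i,j+i]≡gcd[i,j] h k))))
          , (λ c h k _ → trans (reflexive (P.cong (λ n → ι n ^ w) (gcd[ci,cj]≡c*gcd[i,j] (suc c) h k)))
                               (trans (^-congˡ w (ιℕ-homo-* (suc c) (ℕGCD.gcd ℤ.∣ h ∣ ℤ.∣ k ∣))) (^-distrib-* (ιℕ (suc c)) _ w)))

  G-even : IsEvenSym F (G F w)
  G-even h k _ = reflexive (P.cong (λ n → ι n ^ w) (gcd[i,-j]≡gcd[i,j] h k))

  βG≈0 : ∀ h k → β F (G F w) h k ≈ 0#
  βG≈0 h k = trans (+-congˡ (-‿cong (reflexive (P.cong (λ n → ι n ^ w) (gcd[j,-i]≡gcd[i,j] h k))))) (-‿inverseʳ _)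

  G[1,0]≈1 : G F w (+ 1) (+ 0) ≈ 1#
  G[1,0]≈1 = trans (^-congˡ w (+-identityʳ 1#)) (1#^n≈1# w)

  G≉0 : ¬ (_≐_ F (G F w) (0S F))
  G≉0 G≐0 = char0 0 (trans (+-identityʳ 1#) (trans (sym G[1,0]≈1) (G≐0 (+ 1) (+ 0) (ℤ.+<+ ℕ.z<s))))

  0-poly : HomPoly F (w ℕ.+ 2)
  0-poly _ = 0#

  0-poly≈0 : ∀ x y → evalK F 0-poly x y ≈ 0#
  0-poly≈0 = evalK-zero {w ℕ.+ 2}

  0-poly∈U : InU F w 0-poly
  0-poly∈U x y = begin
    x * evalK F 0-poly (x + y) y + y * evalK F 0-poly x (x + y)  ≈⟨ +-cong (*-congˡ (0-poly≈0 _ _)) (*-congˡ (0-poly≈0 _ _)) ⟩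
    x * 0# + y * 0#                                              ≈⟨ solve 2 (λ x y → x :* con 0ℤ :+ y :* con 0ℤ := (x :+ y) :* con 0ℤ) refl x y ⟩
    (x + y) * 0#                                                 ≈⟨ *-congˡ (0-poly≈0 x y) ⟨
    (x + y) * evalK F 0-poly x y                                 ∎

  βG≈hat0 : AgreesWithHat F w 0-poly (β F (G F w))
  βG≈hat0 h k _ _ = begin
    β F (G F w) h k                                  ≈⟨ βG≈0 h k ⟩
    0#                                               ≈⟨ zeroʳ _ ⟨
    ι (h ℤ.* k) ⁻¹ * 0#                              ≈⟨ *-congˡ (-‿inverseʳ 0#) ⟨
    ι (h ℤ.* k) ⁻¹ * (0# - 0#)                       ≈⟨ *-congˡ (+-cong (0-poly≈0 _ _) (-‿cong (trans (*-congʳ (0-poly≈0 _ _)) (zeroˡ _)))) ⟨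
    hat F w 0-poly h k                               ∎

  G∈Ê⁺ : InÊ⁺ F w (G F w)
  G∈Ê⁺ = (G-isWDS , 0-poly , 0-poly∈U , βG≈hat0) , G-even

module BetaWithSign {c ℓ} (F : Field c ℓ) {w : ℕ} (2≤w : 2 ≤ w) (2∣w : 2 ∣ w) (signs : SignPair F) where
  open Field F
  open FieldLemmas F
  open SignPair signs
  open import Relation.Binary.Reasoning.Setoid setoid

  1≤w : 1 ℕ.≤ w
  1≤w = ℕP.≤-trans (ℕ.s≤s ℕ.z≤n) 2≤w

  [-1]^d≈1 : (- 1#) ^ (w ℕ.+ 2) ≈ 1#
  [-1]^d≈1 = -1#^even≈1# (ℕDiv.∣m∣n⇒∣m+n 2∣w ℕDiv.∣-refl)

  HasParity : Sym F → Set ℓ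
  HasParity E = ∀ h k → 0ℤ ℤ.< h → E h (ℤ.- k) ≈ s * E h k

  HatHasParity : HomPoly F (w ℕ.+ 2) → Set ℓ
  HatHasParity g = ∀ h k → 0ℤ ℤ.< h → 0ℤ ℤ.< k → hat F w g h (ℤ.- k) ≈ s * hat F w g h k

  β-symmetric : ∀ E → HasParity E → ∀ a b → β F E (+ suc b) (+ suc a) ≈ σ * β F E (+ suc a) (+ suc b)
  β-symmetric E E-par a b = begin
    E B A - E A (ℤ.- B)         ≈⟨ +-congˡ (-‿cong (E-par A B (ℤ.+<+ ℕ.z<s))) ⟩
    E B A - s * E A B           ≈⟨ +-congʳ (trans (sym (*-identityˡ _)) (*-congʳ (sym s*s≈1))) ⟩
    (s * s) * E B A - s * E A B ≈⟨ solve 3 (λ x y s → (s :* s) :* x :- s :* y := (:- s) :* (y :- s :* x)) refl (E B A) (E A B) s ⟩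
    - s * (E A B - s * E B A)   ≈⟨ *-cong (sym σ≈-s) (+-congˡ (-‿cong (sym (E-par B A (ℤ.+<+ ℕ.z<s))))) ⟩
    σ * (E A B - E B (ℤ.- A))   ∎
    where
    A = + suc a
    B = + suc b

  β-image : ∀ E → InÊ F w E → HasParity E →
    Σ (HomPoly F (w ℕ.+ 2)) λ g → (InU F w g × HatHasParity g) × AgreesWithHat F w g (β F E)
  β-image E (_ , g , g∈U , βE≈ĝ) E-par = g , (g∈U , positive-pairs _ γ-par) , βE≈ĝ
    where
    open Hat F g g∈U
    γ-par : HatParity s
    γ-par = Signed.hatSymmetric⇒hatParity signs [-1]^d≈1 1≤w λ a b → begin
      γ (suc b) (suc a)                  ≈⟨ βE≈ĝ (+ suc b) (+ suc a) (ℤ.+<+ ℕ.z<s) (ℤ.+<+ ℕ.z<s) ⟨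
      β F E (+ suc b) (+ suc a)          ≈⟨ β-symmetric E E-par a b ⟩
      σ * β F E (+ suc a) (+ suc b)      ≈⟨ *-congˡ (βE≈ĝ (+ suc a) (+ suc b) (ℤ.+<+ ℕ.z<s) (ℤ.+<+ ℕ.z<s)) ⟩
      σ * γ (suc a) (suc b)              ∎

  β-preimage : ∀ g → InU F w g → HatHasParity g →
    Σ (Sym F) λ E → (InÊ F w E × HasParity E) × AgreesWithHat F w g (β F E)
  β-preimage g g∈U ĝ-par = E , ((E-isWDS , g , g∈U , βE≈ĝ) , E-parity) , βE≈ĝ
    where
    open Hat F g g∈U
    γ-sym : HatSymmetric σ
    γ-sym = Signed.hatParity⇒hatSymmetric signs 1≤w λ a b → ĝ-par (+ suc a) (+ suc b) (ℤ.+<+ ℕ.z<s) (ℤ.+<+ ℕ.z<s)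
    open Construction.Recursion F w signs γ γ-sym hat-diagonal hat-three-term hat-homogeneous
    βE≈ĝ : AgreesWithHat F w g (β F E)
    βE≈ĝ = positive-pairs _ β-E

module BetaOddEven {c ℓ} (F : Field c ℓ) {w : ℕ} (2≤w : 2 ≤ w) (2∣w : 2 ∣ w) where
  open Field F
  open FieldLemmas F
  open SymbolG F w
  open import Relation.Binary.Reasoning.Setoid setoid
  module Odd  = BetaWithSign F 2≤w 2∣w (odd-signs F)
  module Even = BetaWithSign F 2≤w 2∣w (even-signs F)

  β⁻-image : ∀ E → InÊ⁻ F w E → InÛ⁻ F w (β F E)
  β⁻-image E (E∈Ê , E-odd) =
    let g , (g∈U , ĝ-par) , βE≈ĝ = Odd.β-image E E∈Ê (λ h k 0<h → trans (E-odd h k 0<h) (sym (-1*x≈-x _)))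
    in  g , (g∈U , λ h k 0<h 0<k → trans (ĝ-par h k 0<h 0<k) (-1*x≈-x _)) , βE≈ĝ

  β⁻-injective : ∀ E → InÊ⁻ F w E → BetaVanishes F E → _≐_ F E (0S F)
  β⁻-injective E ((E-wds , _) , E-odd) βE≈0 =
    Kernel.E≐0 F w E E-wds (- 1#) (λ h k 0<h → trans (E-odd h k 0<h) (sym (-1*x≈-x _))) βE≈0
      (x+x≈0⇒x≈0 _ (trans (+-congʳ (E-odd (+ 1) (+ 0) (ℤ.+<+ ℕ.z<s))) (-‿inverseˡ _)))

  β⁻-surjective : ∀ g → InU⁻ F w g → Σ (Sym F) λ E → InÊ⁻ F w E × AgreesWithHat F w g (β F E)
  β⁻-surjective g (g∈U , ĝ-odd) =
    let E , (E∈Ê , E-par) , βE≈ĝ = Odd.β-preimage g g∈U (λ h k 0<h 0<k → trans (ĝ-odd h k 0<h 0<k) (sym (-1*x≈-x _)))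
    in  E , (E∈Ê , λ h k 0<h → trans (E-par h k 0<h) (-1*x≈-x _)) , βE≈ĝ

  β⁺-image : ∀ E → InÊ⁺ F w E → InÛ⁺ F w (β F E)
  β⁺-image E (E∈Ê , E-even) =
    let g , (g∈U , ĝ-par) , βE≈ĝ = Even.β-image E E∈Ê (λ h k 0<h → trans (E-even h k 0<h) (sym (*-identityˡ _)))
    in  g , (g∈U , λ h k 0<h 0<k → trans (ĝ-par h k 0<h 0<k) (*-identityˡ _)) , βE≈ĝ

  β⁺-surjective : ∀ g → InU⁺ F w g → Σ (Sym F) λ E → InÊ⁺ F w E × AgreesWithHat F w g (β F E)
  β⁺-surjective g (g∈U , ĝ-even) =
    let E , (E∈Ê , E-par) , βE≈ĝ = Even.β-preimage g g∈U (λ h k 0<h 0<k → trans (ĝ-even h k 0<h 0<k) (sym (*-identityˡ _)))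
    in  E , (E∈Ê , λ h k 0<h → trans (E-par h k 0<h) (*-identityˡ _)) , βE≈ĝ

  β⁺-kernel : ∀ E → InÊ⁺ F w E → BetaVanishes F E ⇔ Σ Carrier λ a → _≐_ F E (_·S_ F a (G F w))
  β⁺-kernel E ((E-wds , _) , E-even) = mk⇔ to from
    where
    from : (Σ Carrier λ a → _≐_ F E (_·S_ F a (G F w))) → BetaVanishes F E
    from (a , E≐aG) h k 0<h 0<k = begin
      E h k - E k (ℤ.- h)                       ≈⟨ +-cong (E≐aG h k 0<h) (-‿cong (E≐aG k (ℤ.- h) 0<k)) ⟩
      a * G F w h k - a * G F w k (ℤ.- h)       ≈⟨ solve 3 (λ a x y → a :* x :- a :* y := a :* (x :- y)) refl a (G F w h k) (G F w k (ℤ.- h)) ⟩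
      a * β F (G F w) h k                       ≈⟨ *-congˡ (βG≈0 h k) ⟩
      a * 0#                                    ≈⟨ zeroʳ a ⟩
      0#                                        ∎
    to : BetaVanishes F E → Σ Carrier λ a → _≐_ F E (_·S_ F a (G F w))
    to βE≈0 = a , λ h k 0<h → x∙y⁻¹≈ε⇒x≈y _ _ (Kernel.E≐0 F w E′ E′-wds 1# E′-even βE′≈0 E′[1,0]≈0 h k 0<h)
      where
      a = E (+ 1) (+ 0)
      E′ : Sym F
      E′ h k = E h k - a * G F w h k
      E′-wds : IsWDS F w E′
      E′-wds = (λ h k 0<h → +-cong (proj₁ E-wds h k 0<h) (-‿cong (*-congˡ (proj₁ G-isWDS h k 0<h))))
             , (λ c h k 0<h → trans (+-cong (proj₂ E-wds c h k 0<h) (-‿cong (*-congˡ (proj₂ G-isWDS c h k 0<h))))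
                 (solve 4 (λ t x a y → t :* x :- a :* (t :* y) := t :* (x :- a :* y)) refl (ι (+ suc c) ^ w) (E h k) a (G F w h k)))
      E′-even : ∀ h k → 0ℤ ℤ.< h → E′ h (ℤ.- k) ≈ 1# * E′ h k
      E′-even h k 0<h = trans (+-cong (E-even h k 0<h) (-‿cong (*-congˡ (G-even h k 0<h)))) (sym (*-identityˡ _))
      βE′≈0 : BetaVanishes F E′
      βE′≈0 h k 0<h 0<k = begin
        (E h k - a * G F w h k) - (E k (ℤ.- h) - a * G F w k (ℤ.- h))
          ≈⟨ solve 5 (λ x a y u v → (x :- a :* y) :- (u :- a :* v) := (x :- u) :- a :* (y :- v)) refl (E h k) a (G F w h k) (E k (ℤ.- h)) (G F w k (ℤ.- h)) ⟩
        β F E h k - a * β F (G F w) h k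
          ≈⟨ +-cong (βE≈0 h k 0<h 0<k) (-‿cong (*-congˡ (βG≈0 h k))) ⟩
        0# - a * 0#     ≈⟨ solve 1 (λ a → con 0ℤ :- a :* con 0ℤ := con 0ℤ) refl a ⟩
        0#              ∎
      E′[1,0]≈0 : E′ (+ 1) (+ 0) ≈ 0#
      E′[1,0]≈0 = trans (+-congˡ (-‿cong (trans (*-congˡ G[1,0]≈1) (*-identityʳ a)))) (-‿inverseʳ a)

theorem2p4 : ∀ {c ℓ} (F : Field c ℓ) (w : ℕ) → 2 ≤ w → 2 ∣ w →
    -- odd part: β⁻ : Ê⁻ → Û⁻ is well defined, injective and surjective
    ( (∀ E → InÊ⁻ F w E → InÛ⁻ F w (β F E))
    × (∀ E → InÊ⁻ F w E → (∀ h k → 0ℤ ℤ.< h → 0ℤ ℤ.< k → Field._≈_ F (β F E h k) (Field.0# F)) → _≐_ F E (0S F))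
    × (∀ g → InU⁻ F w g → Σ (Defs.Sym F) λ E → InÊ⁻ F w E × AgreesWithHat F w g (β F E)) )
    -- even part: β⁺ : Ê⁺ → Û⁺ is well defined and surjective, with kernel spanned by G_w ≠ 0
  × ( (∀ E → InÊ⁺ F w E → InÛ⁺ F w (β F E))
    × (∀ g → InU⁺ F w g → Σ (Defs.Sym F) λ E → InÊ⁺ F w E × AgreesWithHat F w g (β F E))
    × InÊ⁺ F w (G F w)
    × ¬ (_≐_ F (G F w) (0S F))
    × (∀ E → InÊ⁺ F w E →
        ((∀ h k → 0ℤ ℤ.< h → 0ℤ ℤ.< k → Field._≈_ F (β F E h k) (Field.0# F))
         ⇔ Σ (Field.Carrier F) λ a → _≐_ F E (_·S_ F a (G F w)))) )
theorem2p4 F w 2≤w 2∣w =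
    (β⁻-image , β⁻-injective , β⁻-surjective)
  , (β⁺-image , β⁺-surjective , G∈Ê⁺ , G≉0 , β⁺-kernel)
  where
  open BetaOddEven F 2≤w 2∣w
  open SymbolG F w
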